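{- Let $q$ be a nonzero complex number, $n$ a non-negative integer, and $a,b$ nonzero complex numbers such that no denominator below vanishes. Then \[ \sum_{k=0}^n \frac{(q^{ -2n},\, -aq^2/b,\, a^2q^2/b^4,\, -aq^{2n-1},\, aq/b;q^2)_k}{(a^2q^{2n+2}/b^2,\, -aq^{3-2n}/b^2,\, -a/b,\, aq/b,\, q^2;q^2)_k}\,q^{2k} =\frac{(-aq/b^2,\, a^2q^2/b^2;q^2)_n\,(b,\, -b/q;q)_{2n}}{(b^2,\, -b^2/(aq);q^2)_n\,(aq/b,\, -a/b;q)_{2n}}. \]
   Context: For a base $Q$ and non-negative integer $k$, $(x;Q)_k=\prod_{i=0}^{k-1}(1-xQ^i)$, and $(x_1,\dots,x_r;Q)_k=\prod_{i=1}^r(x_i;Q)_k$. -}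

module Defs where

open import Level using (Level; _⊔_) renaming (suc to lsuc)
open import Data.Nat using (ℕ; zero; suc)
open import Relation.Nullary using (¬_)
open import Algebra.Bundles using (CommutativeRing)

-- The inverse is a total operation `_⁻¹`
-- (its value at 0 is unconstrained), so that division is a total function
-- and "no denominator vanishes" can be stated as a hypothesis.
record Field (c ℓ : Level) : Set (lsuc (c ⊔ ℓ)) where
  field
    commutativeRing : CommutativeRing c ℓ
  open CommutativeRing commutativeRing public
  infix 8 _⁻¹
  field
    _⁻¹       : Carrier → Carrier
    ⁻¹-cong   : ∀ {x y} → x ≈ y → x ⁻¹ ≈ y ⁻¹
    *-inverse : ∀ {x} → ¬ (x ≈ 0#) → x * x ⁻¹ ≈ 1#
    1≉0       : ¬ (1# ≈ 0#)

module FieldOps {c ℓ : Level} (F : Field c ℓ) where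
  open Field F hiding (zero)

  infixl 7 _÷_
  _÷_ : Carrier → Carrier → Carrier
  x ÷ y = x * y ⁻¹

  infixr 8 _^_
  _^_ : Carrier → ℕ → Carrier
  x ^ zero  = 1#
  x ^ suc n = x * x ^ n

  ⟦_⟧ : ℕ → Carrier
  ⟦ zero ⟧  = 0#
  ⟦ suc n ⟧ = 1# + ⟦ n ⟧

  CharZero : Set ℓ
  CharZero = ∀ n → ¬ (⟦ suc n ⟧ ≈ 0#)

  poch : Carrier → Carrier → ℕ → Carrier
  poch x Q zero    = 1#
  poch x Q (suc k) = poch x Q k * (1# - x * Q ^ k)

  sumTo : ℕ → (ℕ → Carrier) → Carrier
  sumTo zero    f = f zero
  sumTo (suc n) f = sumTo n f + f (suc n)

module Submission where

-- Creative telescoping (Zeilberger's method).  Let t(n,k) be the summand, S(n) the sum and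
-- Num(n)/Den(n) the right-hand side, and let δ(n) = Den(n+1)/Den(n), ν(n) = Num(n+1)/Num(n),
-- both products of six linear factors in q^(2n).  For an explicit G(n,k) — hypergeometric in k
-- times a rational certificate in q^(2n) and q^(2k), with G(n,0) = 0 —
--   δ(n) t(n+1,k) - ν(n) t(n,k) = G(n,k+1) - G(n,k)                (k < n),
--   δ(n) (t(n+1,n) + t(n+1,n+1)) - ν(n) t(n,n) = - G(n,n),
-- so summing over k gives δ(n) S(n+1) = ν(n) S(n).  The right-hand side satisfies the same
-- recurrence and S(0) = 1 = Num(0)/Den(0).  After dividing out the q-Pochhammer factors common
-- to the terms involved, each local identity is an identity between Laurent polynomials in
-- q, a, b, q^(2n), q^(2k), checked by a normaliser for such polynomials.  Nonvanishing of every
-- denominator used follows from the hypotheses at n+1, which also imply those at n.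

open import Defs
open import Level using (Level)
open import Algebra.Bundles using (CommutativeRing)
open import Data.Nat as ℕ using (ℕ; zero; suc; _≤_; _<_; z≤n; s≤s)
import Data.Nat.Properties as ℕ
open import Data.Integer as ℤ using (ℤ; +_; -[1+_])
import Data.Integer.Properties as ℤ
open import Data.Fin using (Fin; zero; suc)
import Data.Fin.Properties as Fin
open import Data.Bool using (if_then_else_)
open import Data.Vec as Vec using (Vec; []; _∷_; lookup)
open import Data.Vec.Relation.Binary.Lex.Strict as Lex using ()
open import Data.Vec.Relation.Binary.Pointwise.Inductive using (Pointwise; Pointwise-≡⇒≡)
open import Data.List using (List; []; _∷_; map; foldl)
open import Data.Maybe as Maybe using (Maybe; just; nothing)
open import Data.Product using (_×_; _,_)
open import Data.Sum using (inj₁; inj₂)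
open import Relation.Binary.Definitions using (Trichotomous; Tri; tri<; tri≈; tri>)
open import Relation.Binary.PropositionalEquality as ≡ using (_≡_)
open import Relation.Nullary using (¬_; does; yes; no)
import Relation.Binary.Reasoning.Setoid as SetoidReasoning
import Algebra.Properties.Ring as RingProperties
import Algebra.Properties.CommutativeSemigroup as CommutativeSemigroupProperties
import Algebra.Properties.CommutativeSemiring.Exp as ExpProperties

module FieldProperties {c ℓ : Level} (F : Field c ℓ) where
  open Field F hiding (zero)
  open FieldOps F
  open SetoidReasoning setoid
  open CommutativeSemigroupProperties *-commutativeSemigroup public using (interchange)
  private module Exp = ExpProperties commutativeSemiring

  ≉0-* : ∀ {x y} → ¬ x ≈ 0# → ¬ y ≈ 0# → ¬ x * y ≈ 0#
  ≉0-* {x} {y} x≉0 y≉0 xy≈0 = y≉0 (begin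
    y                ≈⟨ *-identityˡ y ⟨
    1# * y           ≈⟨ *-congʳ (*-inverse x≉0) ⟨
    x * x ⁻¹ * y     ≈⟨ *-congʳ (*-comm x (x ⁻¹)) ⟩
    x ⁻¹ * x * y     ≈⟨ *-assoc (x ⁻¹) x y ⟩
    x ⁻¹ * (x * y)   ≈⟨ *-congˡ xy≈0 ⟩
    x ⁻¹ * 0#        ≈⟨ zeroʳ _ ⟩
    0#               ∎)

  ≉0-*ˡ : ∀ {x y} → ¬ x * y ≈ 0# → ¬ x ≈ 0#
  ≉0-*ˡ {x} {y} xy≉0 x≈0 = xy≉0 (trans (*-congʳ x≈0) (zeroˡ y))

  ≉0-*ʳ : ∀ {x y} → ¬ x * y ≈ 0# → ¬ y ≈ 0#
  ≉0-*ʳ {x} {y} xy≉0 y≈0 = xy≉0 (trans (*-congˡ y≈0) (zeroʳ x))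

  ≉0-resp-≈ : ∀ {x y} → x ≈ y → ¬ x ≈ 0# → ¬ y ≈ 0#
  ≉0-resp-≈ x≈y x≉0 y≈0 = x≉0 (trans x≈y y≈0)

  ⁻¹-unique : ∀ {x y} → x * y ≈ 1# → x ⁻¹ ≈ y
  ⁻¹-unique {x} {y} xy≈1 = begin
    x ⁻¹              ≈⟨ *-identityʳ _ ⟨
    x ⁻¹ * 1#         ≈⟨ *-congˡ xy≈1 ⟨
    x ⁻¹ * (x * y)    ≈⟨ *-assoc _ _ _ ⟨
    x ⁻¹ * x * y      ≈⟨ *-congʳ (*-comm _ _) ⟩
    x * x ⁻¹ * y      ≈⟨ *-congʳ (*-inverse x≉0) ⟩
    1# * y            ≈⟨ *-identityˡ y ⟩
    y                 ∎
    where
    x≉0 : ¬ x ≈ 0#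
    x≉0 x≈0 = 1≉0 (begin 1# ≈⟨ xy≈1 ⟨ x * y ≈⟨ *-congʳ x≈0 ⟩ 0# * y ≈⟨ zeroˡ y ⟩ 0# ∎)

  y*x≈z⇒x≈z÷y : ∀ {x y z} → ¬ y ≈ 0# → y * x ≈ z → x ≈ z ÷ y
  y*x≈z⇒x≈z÷y {x} {y} {z} y≉0 yx≈z = begin
    x                 ≈⟨ *-identityʳ x ⟨
    x * 1#            ≈⟨ *-congˡ (*-inverse y≉0) ⟨
    x * (y * y ⁻¹)    ≈⟨ *-assoc _ _ _ ⟨
    x * y * y ⁻¹      ≈⟨ *-congʳ (trans (*-comm x y) yx≈z) ⟩
    z * y ⁻¹          ∎

  ^≡^ : ∀ x n → x ^ n ≡ x Exp.^ n
  ^≡^ x zero    = ≡.refl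
  ^≡^ x (suc n) = ≡.cong (x *_) (^≡^ x n)

  ^-homo-* : ∀ x m n → x ^ (m ℕ.+ n) ≈ x ^ m * x ^ n
  ^-homo-* x m n rewrite ^≡^ x (m ℕ.+ n) | ^≡^ x m | ^≡^ x n = Exp.^-homo-* x m n

  ^-congˡ : ∀ {x y} n → x ≈ y → x ^ n ≈ y ^ n
  ^-congˡ zero    x≈y = refl
  ^-congˡ (suc n) x≈y = *-cong x≈y (^-congˡ n x≈y)

  inverse-^ : ∀ {x y} n → x * y ≈ 1# → x ^ n * y ^ n ≈ 1#
  inverse-^ {x} {y} zero    xy≈1 = *-identityˡ 1#
  inverse-^ {x} {y} (suc n) xy≈1 = begin
    x * x ^ n * (y * y ^ n)     ≈⟨ interchange x (x ^ n) y (y ^ n) ⟩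
    x * y * (x ^ n * y ^ n)     ≈⟨ *-cong xy≈1 (inverse-^ n xy≈1) ⟩
    1# * 1#                     ≈⟨ *-identityˡ 1# ⟩
    1#                          ∎

-- Normalisation of Laurent polynomial expressions

infixl 6 _⊕_ _⊖_
infixl 7 _⊗_
infix 8 _⊛_
data Expr (n : ℕ) : Set where
  var var⁻¹ : Fin n → Expr n
  1ₑ 0ₑ     : Expr n
  _⊕_ _⊗_ _⊖_ : Expr n → Expr n → Expr n
  ⊝_        : Expr n → Expr n
  _⊛_       : Expr n → ℕ → Expr n
  _⁻        : Expr n → Expr n

-- Normal forms: integer combinations of Laurent monomials (exponent vectors),
-- strictly increasing in the lexicographic order and with nonzero coefficients.
Monomial : ℕ → Set
Monomial n = Vec ℤ n

Polynomial : ℕ → Set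
Polynomial n = List (ℤ × Monomial n)

triCase : ∀ {a b c p} {A : Set a} {B : Set b} {C : Set c} {P : Set p} → Tri A B C → P → P → P → P
triCase (tri< _ _ _) x y z = x
triCase (tri≈ _ _ _) x y z = y
triCase (tri> _ _ _) x y z = z

module _ {n : ℕ} where

  compareᴹ : Trichotomous (Pointwise _≡_) (Lex.Lex-< _≡_ ℤ._<_ {n} {n})
  compareᴹ = Lex.<-cmp ≡.sym ℤ.<-cmp

  infixr 5 _∷?_
  _∷?_ : ℤ × Monomial n → Polynomial n → Polynomial n
  (+ zero , m) ∷? p = p
  t            ∷? p = t ∷ p

  infixl 6 _+ᴾ_
  _+ᴾ_ : Polynomial n → Polynomial n → Polynomial n
  []            +ᴾ r             = r
  (t ∷ p)       +ᴾ []            = t ∷ p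
  ((c , m) ∷ p) +ᴾ ((d , k) ∷ r) = triCase (compareᴹ m k)
    ((c , m) ∷ (p +ᴾ ((d , k) ∷ r)))
    ((c ℤ.+ d , m) ∷? (p +ᴾ r))
    ((d , k) ∷ (((c , m) ∷ p) +ᴾ r))

  _*ᵀ_ : ℤ × Monomial n → Polynomial n → Polynomial n
  (c , m) *ᵀ r = map (λ { (d , k) → c ℤ.* d , Vec.zipWith ℤ._+_ m k }) r

  infixl 7 _*ᴾ_
  _*ᴾ_ : Polynomial n → Polynomial n → Polynomial n
  []      *ᴾ r = []
  (t ∷ p) *ᴾ r = t *ᵀ r +ᴾ p *ᴾ r

  -ᴾ_ : Polynomial n → Polynomial n
  -ᴾ p = map (λ { (c , m) → ℤ.- c , m }) p

  1ᴹ : Monomial n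
  1ᴹ = Vec.replicate n (+ 0)

  1ᴾ : Polynomial n
  1ᴾ = (+ 1 , 1ᴹ) ∷ []

  infixr 8 _^ᴾ_
  _^ᴾ_ : Polynomial n → ℕ → Polynomial n
  p ^ᴾ zero  = 1ᴾ
  p ^ᴾ suc k = p *ᴾ p ^ᴾ k

  -- Only ± a monomial is inverted; normalisation fails on any other inverse.
  _⁻ᴾ : Polynomial n → Maybe (Polynomial n)
  ((+ 1    , m) ∷ []) ⁻ᴾ = just ((+ 1    , Vec.map ℤ.-_ m) ∷ [])
  ((-[1+ 0 ] , m) ∷ []) ⁻ᴾ = just ((-[1+ 0 ] , Vec.map ℤ.-_ m) ∷ [])
  _                 ⁻ᴾ = nothing

unitᴹ : ∀ {n} → ℤ → Fin n → Monomial n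
unitᴹ e zero    = e ∷ 1ᴹ
unitᴹ e (suc i) = + 0 ∷ unitᴹ e i

normalise : ∀ {n} → Expr n → Maybe (Polynomial n)
normalise (var i)   = just ((+ 1 , unitᴹ (+ 1) i) ∷ [])
normalise (var⁻¹ i) = just ((+ 1 , unitᴹ -[1+ 0 ] i) ∷ [])
normalise 1ₑ        = just 1ᴾ
normalise 0ₑ        = just []
normalise (e ⊕ f)   = Maybe.zipWith _+ᴾ_ (normalise e) (normalise f)
normalise (e ⊗ f)   = Maybe.zipWith _*ᴾ_ (normalise e) (normalise f)
normalise (e ⊖ f)   = Maybe.zipWith (λ p r → p +ᴾ -ᴾ r) (normalise e) (normalise f)
normalise (⊝ e)     = Maybe.map -ᴾ_ (normalise e)
normalise (e ⊛ k)   = Maybe.map (_^ᴾ k) (normalise e)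
normalise (e ⁻)     = normalise e Maybe.>>= _⁻ᴾ

_[_≔_,_] : ∀ {n} → Expr n → Fin n → Expr n → Expr n → Expr n
var j   [ i ≔ s , s′ ] = if does (i Fin.≟ j) then s  else var j
var⁻¹ j [ i ≔ s , s′ ] = if does (i Fin.≟ j) then s′ else var⁻¹ j
1ₑ      [ i ≔ s , s′ ] = 1ₑ
0ₑ      [ i ≔ s , s′ ] = 0ₑ
(e ⊕ f) [ i ≔ s , s′ ] = e [ i ≔ s , s′ ] ⊕ f [ i ≔ s , s′ ]
(e ⊗ f) [ i ≔ s , s′ ] = e [ i ≔ s , s′ ] ⊗ f [ i ≔ s , s′ ]
(e ⊖ f) [ i ≔ s , s′ ] = e [ i ≔ s , s′ ] ⊖ f [ i ≔ s , s′ ]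
(⊝ e)   [ i ≔ s , s′ ] = ⊝ (e [ i ≔ s , s′ ])
(e ⊛ k) [ i ≔ s , s′ ] = (e [ i ≔ s , s′ ]) ⊛ k
(e ⁻)   [ i ≔ s , s′ ] = (e [ i ≔ s , s′ ]) ⁻

module LaurentSemantics {c ℓ : Level} (F : Field c ℓ) where
  open Field F hiding (zero)
  open FieldOps F renaming (⟦_⟧ to fromℕ)
  open FieldProperties F
  open SetoidReasoning setoid
  open RingProperties ring using (-‿distribˡ-*; -‿distribʳ-*)
  open import Algebra.Properties.AbelianGroup +-abelianGroup using (⁻¹-∙-comm)
  open import Algebra.Properties.Group +-group using (⁻¹-involutive; ε⁻¹≈ε)
  open CommutativeSemigroupProperties +-commutativeSemigroup using (x∙yz≈y∙xz) renaming (interchange to +-interchange)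

  record Invertible : Set (c Level.⊔ ℓ) where
    constructor invertible
    field
      value inverse     : Carrier
      value*inverse≈1   : value * inverse ≈ 1#
  open Invertible

  Env : ℕ → Set (c Level.⊔ ℓ)
  Env = Vec Invertible

  ⟦_⟧ : ∀ {n} → Expr n → Env n → Carrier
  ⟦ var i   ⟧ ρ = value (lookup ρ i)
  ⟦ var⁻¹ i ⟧ ρ = inverse (lookup ρ i)
  ⟦ 1ₑ      ⟧ ρ = 1#
  ⟦ 0ₑ      ⟧ ρ = 0#
  ⟦ e ⊕ f   ⟧ ρ = ⟦ e ⟧ ρ + ⟦ f ⟧ ρ
  ⟦ e ⊗ f   ⟧ ρ = ⟦ e ⟧ ρ * ⟦ f ⟧ ρ
  ⟦ e ⊖ f   ⟧ ρ = ⟦ e ⟧ ρ - ⟦ f ⟧ ρ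
  ⟦ ⊝ e     ⟧ ρ = - ⟦ e ⟧ ρ
  ⟦ e ⊛ k   ⟧ ρ = ⟦ e ⟧ ρ ^ k
  ⟦ e ⁻     ⟧ ρ = ⟦ e ⟧ ρ ⁻¹

  fromℕ-+ : ∀ m n → fromℕ (m ℕ.+ n) ≈ fromℕ m + fromℕ n
  fromℕ-+ zero    n = sym (+-identityˡ _)
  fromℕ-+ (suc m) n = trans (+-congˡ (fromℕ-+ m n)) (sym (+-assoc _ _ _))

  fromℕ-* : ∀ m n → fromℕ (m ℕ.* n) ≈ fromℕ m * fromℕ n
  fromℕ-* zero    n = sym (zeroˡ _)
  fromℕ-* (suc m) n = begin
    fromℕ (n ℕ.+ m ℕ.* n)              ≈⟨ fromℕ-+ n (m ℕ.* n) ⟩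
    fromℕ n + fromℕ (m ℕ.* n)          ≈⟨ +-cong (sym (*-identityˡ _)) (fromℕ-* m n) ⟩
    1# * fromℕ n + fromℕ m * fromℕ n   ≈⟨ distribʳ _ _ _ ⟨
    (1# + fromℕ m) * fromℕ n           ∎

  fromℤ : ℤ → Carrier
  fromℤ (+ n)     = fromℕ n
  fromℤ -[1+ n ]  = - fromℕ (suc n)

  fromℤ-neg : ∀ i → fromℤ (ℤ.- i) ≈ - fromℤ i
  fromℤ-neg (+ zero)  = sym ε⁻¹≈ε
  fromℤ-neg (+ suc n) = refl
  fromℤ-neg -[1+ n ]  = sym (⁻¹-involutive _)

  fromℤ-⊖ : ∀ m n → fromℤ (m ℤ.⊖ n) ≈ fromℕ m - fromℕ n
  fromℤ-⊖ m       zero    = sym (trans (+-congˡ ε⁻¹≈ε) (+-identityʳ _))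
  fromℤ-⊖ zero    (suc n) = sym (+-identityˡ _)
  fromℤ-⊖ (suc m) (suc n) rewrite ℤ.[1+m]⊖[1+n]≡m⊖n m n = begin
    fromℤ (m ℤ.⊖ n)                      ≈⟨ fromℤ-⊖ m n ⟩
    fromℕ m - fromℕ n                    ≈⟨ +-identityˡ _ ⟨
    0# + (fromℕ m - fromℕ n)             ≈⟨ +-congʳ (-‿inverseʳ 1#) ⟨
    1# - 1# + (fromℕ m - fromℕ n)        ≈⟨ +-interchange 1# (- 1#) (fromℕ m) (- fromℕ n) ⟩
    (1# + fromℕ m) + (- 1# - fromℕ n)    ≈⟨ +-congˡ (⁻¹-∙-comm 1# (fromℕ n)) ⟩
    (1# + fromℕ m) - (1# + fromℕ n)      ∎

  fromℤ-+ : ∀ i j → fromℤ (i ℤ.+ j) ≈ fromℤ i + fromℤ j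
  fromℤ-+ (+ m)    (+ n)    = fromℕ-+ m n
  fromℤ-+ (+ m)    -[1+ n ] = fromℤ-⊖ m (suc n)
  fromℤ-+ -[1+ m ] (+ n)    = trans (fromℤ-⊖ n (suc m)) (+-comm _ _)
  fromℤ-+ -[1+ m ] -[1+ n ] = begin
    - fromℕ (suc (suc (m ℕ.+ n)))          ≡⟨ ≡.cong (λ k → - fromℕ (suc k)) (ℕ.+-suc m n) ⟨
    - fromℕ (suc m ℕ.+ suc n)            ≈⟨ -‿cong (fromℕ-+ (suc m) (suc n)) ⟩
    - (fromℕ (suc m) + fromℕ (suc n))    ≈⟨ ⁻¹-∙-comm _ _ ⟨
    - fromℕ (suc m) - fromℕ (suc n)      ∎

  fromℤ-pos-* : ∀ m n → fromℤ (+ m ℤ.* + n) ≈ fromℕ m * fromℕ n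
  fromℤ-pos-* m n rewrite ≡.sym (ℤ.pos-* m n) = fromℕ-* m n

  fromℤ-* : ∀ i j → fromℤ (i ℤ.* j) ≈ fromℤ i * fromℤ j
  fromℤ-* (+ m) (+ n) = fromℤ-pos-* m n
  fromℤ-* (+ m) -[1+ n ] rewrite ≡.sym (ℤ.neg-distribʳ-* (+ m) (+ suc n)) = begin
    fromℤ (ℤ.- (+ m ℤ.* + suc n))     ≈⟨ fromℤ-neg (+ m ℤ.* + suc n) ⟩
    - fromℤ (+ m ℤ.* + suc n)         ≈⟨ -‿cong (fromℤ-pos-* m (suc n)) ⟩
    - (fromℕ m * fromℕ (suc n))       ≈⟨ -‿distribʳ-* _ _ ⟩
    fromℕ m * - fromℕ (suc n)         ∎
  fromℤ-* -[1+ m ] (+ n) rewrite ≡.sym (ℤ.neg-distribˡ-* (+ suc m) (+ n)) = begin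
    fromℤ (ℤ.- (+ suc m ℤ.* + n))     ≈⟨ fromℤ-neg (+ suc m ℤ.* + n) ⟩
    - fromℤ (+ suc m ℤ.* + n)         ≈⟨ -‿cong (fromℤ-pos-* (suc m) n) ⟩
    - (fromℕ (suc m) * fromℕ n)       ≈⟨ -‿distribˡ-* _ _ ⟩
    - fromℕ (suc m) * fromℕ n         ∎
  fromℤ-* -[1+ m ] -[1+ n ] = begin
    fromℕ (suc m ℕ.* suc n)                 ≈⟨ fromℕ-* (suc m) (suc n) ⟩
    fromℕ (suc m) * fromℕ (suc n)           ≈⟨ ⁻¹-involutive _ ⟨
    - - (fromℕ (suc m) * fromℕ (suc n))     ≈⟨ -‿cong (-‿distribˡ-* _ _) ⟩
    - (- fromℕ (suc m) * fromℕ (suc n))     ≈⟨ -‿distribʳ-* _ _ ⟩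
    - fromℕ (suc m) * - fromℕ (suc n)       ∎

  infixr 8 _^ᶻ_
  _^ᶻ_ : Invertible → ℤ → Carrier
  u ^ᶻ + k      = value u ^ k
  u ^ᶻ -[1+ k ] = inverse u ^ suc k

  ^ᶻ-⊖ : ∀ u m n → u ^ᶻ (m ℤ.⊖ n) ≈ value u ^ m * inverse u ^ n
  ^ᶻ-⊖ u m       zero    = sym (*-identityʳ _)
  ^ᶻ-⊖ u zero    (suc n) = sym (*-identityˡ _)
  ^ᶻ-⊖ u (suc m) (suc n) rewrite ℤ.[1+m]⊖[1+n]≡m⊖n m n = begin
    u ^ᶻ (m ℤ.⊖ n)                       ≈⟨ ^ᶻ-⊖ u m n ⟩
    x ^ m * y ^ n                        ≈⟨ *-identityˡ _ ⟨
    1# * (x ^ m * y ^ n)                 ≈⟨ *-congʳ (value*inverse≈1 u) ⟨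
    x * y * (x ^ m * y ^ n)              ≈⟨ interchange x y (x ^ m) (y ^ n) ⟩
    x * x ^ m * (y * y ^ n)              ∎
    where
    x y : Carrier
    x = value u
    y = inverse u

  ^ᶻ-+ : ∀ u i j → u ^ᶻ (i ℤ.+ j) ≈ u ^ᶻ i * u ^ᶻ j
  ^ᶻ-+ u (+ m)    (+ n)    = ^-homo-* (value u) m n
  ^ᶻ-+ u (+ m)    -[1+ n ] = ^ᶻ-⊖ u m (suc n)
  ^ᶻ-+ u -[1+ m ] (+ n)    = trans (^ᶻ-⊖ u n (suc m)) (*-comm _ _)
  ^ᶻ-+ u -[1+ m ] -[1+ n ] = begin
    y * y ^ suc (m ℕ.+ n)          ≡⟨ ≡.cong (λ k → y ^ suc k) (ℕ.+-suc m n) ⟨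
    y ^ (suc m ℕ.+ suc n)          ≈⟨ ^-homo-* y (suc m) (suc n) ⟩
    y ^ suc m * y ^ suc n          ∎
    where
    y : Carrier
    y = inverse u

  ^ᶻ-neg : ∀ u i → u ^ᶻ (ℤ.- i) * u ^ᶻ i ≈ 1#
  ^ᶻ-neg u (+ zero)  = *-identityˡ 1#
  ^ᶻ-neg u (+ suc n) = trans (*-comm _ _) (inverse-^ (suc n) (value*inverse≈1 u))
  ^ᶻ-neg u -[1+ n ]  = inverse-^ (suc n) (value*inverse≈1 u)

  ⟦_⟧ᴹ : ∀ {n} → Monomial n → Env n → Carrier
  ⟦ []    ⟧ᴹ []      = 1#
  ⟦ e ∷ m ⟧ᴹ (u ∷ ρ) = u ^ᶻ e * ⟦ m ⟧ᴹ ρ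

  ⟦1ᴹ⟧ : ∀ {n} (ρ : Env n) → ⟦ 1ᴹ ⟧ᴹ ρ ≈ 1#
  ⟦1ᴹ⟧ []      = refl
  ⟦1ᴹ⟧ (u ∷ ρ) = trans (*-identityˡ _) (⟦1ᴹ⟧ ρ)

  ⟦unitᴹ⟧ : ∀ {n} e (i : Fin n) ρ → ⟦ unitᴹ e i ⟧ᴹ ρ ≈ lookup ρ i ^ᶻ e
  ⟦unitᴹ⟧ e zero    (u ∷ ρ) = trans (*-congˡ (⟦1ᴹ⟧ ρ)) (*-identityʳ _)
  ⟦unitᴹ⟧ e (suc i) (u ∷ ρ) = trans (*-identityˡ _) (⟦unitᴹ⟧ e i ρ)

  ⟦*ᴹ⟧ : ∀ {n} (m k : Monomial n) ρ → ⟦ Vec.zipWith ℤ._+_ m k ⟧ᴹ ρ ≈ ⟦ m ⟧ᴹ ρ * ⟦ k ⟧ᴹ ρ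
  ⟦*ᴹ⟧ []      []      []      = sym (*-identityˡ 1#)
  ⟦*ᴹ⟧ (e ∷ m) (f ∷ k) (u ∷ ρ) = begin
    u ^ᶻ (e ℤ.+ f) * ⟦ Vec.zipWith ℤ._+_ m k ⟧ᴹ ρ   ≈⟨ *-cong (^ᶻ-+ u e f) (⟦*ᴹ⟧ m k ρ) ⟩
    u ^ᶻ e * u ^ᶻ f * (⟦ m ⟧ᴹ ρ * ⟦ k ⟧ᴹ ρ)          ≈⟨ interchange _ _ _ _ ⟩
    u ^ᶻ e * ⟦ m ⟧ᴹ ρ * (u ^ᶻ f * ⟦ k ⟧ᴹ ρ)          ∎

  ⟦⁻ᴹ⟧ : ∀ {n} (m : Monomial n) ρ → ⟦ Vec.map ℤ.-_ m ⟧ᴹ ρ * ⟦ m ⟧ᴹ ρ ≈ 1#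
  ⟦⁻ᴹ⟧ []      []      = *-identityˡ 1#
  ⟦⁻ᴹ⟧ (e ∷ m) (u ∷ ρ) = begin
    u ^ᶻ (ℤ.- e) * ⟦ Vec.map ℤ.-_ m ⟧ᴹ ρ * (u ^ᶻ e * ⟦ m ⟧ᴹ ρ)   ≈⟨ interchange _ _ _ _ ⟩
    u ^ᶻ (ℤ.- e) * u ^ᶻ e * (⟦ Vec.map ℤ.-_ m ⟧ᴹ ρ * ⟦ m ⟧ᴹ ρ)   ≈⟨ *-cong (^ᶻ-neg u e) (⟦⁻ᴹ⟧ m ρ) ⟩
    1# * 1#                                                      ≈⟨ *-identityˡ 1# ⟩
    1#                                                           ∎

  ⟦_⟧ᵀ : ∀ {n} → ℤ × Monomial n → Env n → Carrier
  ⟦ c , m ⟧ᵀ ρ = fromℤ c * ⟦ m ⟧ᴹ ρ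

  ⟦_⟧ᴾ : ∀ {n} → Polynomial n → Env n → Carrier
  ⟦ []    ⟧ᴾ ρ = 0#
  ⟦ t ∷ p ⟧ᴾ ρ = ⟦ t ⟧ᵀ ρ + ⟦ p ⟧ᴾ ρ

  module _ {n : ℕ} (ρ : Env n) where

    ∷?-sound : ∀ t p → ⟦ t ∷? p ⟧ᴾ ρ ≈ ⟦ t ⟧ᵀ ρ + ⟦ p ⟧ᴾ ρ
    ∷?-sound (+ zero    , m) p = sym (trans (+-congʳ (zeroˡ _)) (+-identityˡ _))
    ∷?-sound (+ suc _   , m) p = refl
    ∷?-sound (-[1+ _ ]  , m) p = refl

    private
      merge-sound : ∀ {a b} {A : Set a} {B : Set b} {c d m k p r} (o : Tri A (Pointwise _≡_ m k) B) →
        ⟦ p +ᴾ ((d , k) ∷ r) ⟧ᴾ ρ ≈ ⟦ p ⟧ᴾ ρ + ⟦ (d , k) ∷ r ⟧ᴾ ρ →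
        ⟦ p +ᴾ r ⟧ᴾ ρ ≈ ⟦ p ⟧ᴾ ρ + ⟦ r ⟧ᴾ ρ →
        ⟦ ((c , m) ∷ p) +ᴾ r ⟧ᴾ ρ ≈ ⟦ (c , m) ∷ p ⟧ᴾ ρ + ⟦ r ⟧ᴾ ρ →
        ⟦ triCase o ((c , m) ∷ (p +ᴾ ((d , k) ∷ r))) ((c ℤ.+ d , m) ∷? (p +ᴾ r)) ((d , k) ∷ (((c , m) ∷ p) +ᴾ r)) ⟧ᴾ ρ
          ≈ ⟦ (c , m) ∷ p ⟧ᴾ ρ + ⟦ (d , k) ∷ r ⟧ᴾ ρ
      merge-sound {c = c} {d} {m} {k} {p} {r} (tri< _ _ _) ih _ _ = begin
        ⟦ c , m ⟧ᵀ ρ + ⟦ p +ᴾ ((d , k) ∷ r) ⟧ᴾ ρ            ≈⟨ +-congˡ ih ⟩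
        ⟦ c , m ⟧ᵀ ρ + (⟦ p ⟧ᴾ ρ + ⟦ (d , k) ∷ r ⟧ᴾ ρ)       ≈⟨ +-assoc _ _ _ ⟨
        ⟦ c , m ⟧ᵀ ρ + ⟦ p ⟧ᴾ ρ + ⟦ (d , k) ∷ r ⟧ᴾ ρ         ∎
      merge-sound {c = c} {d} {m} {k} {p} {r} (tri> _ _ _) _ _ ih = begin
        ⟦ d , k ⟧ᵀ ρ + ⟦ ((c , m) ∷ p) +ᴾ r ⟧ᴾ ρ            ≈⟨ +-congˡ ih ⟩
        ⟦ d , k ⟧ᵀ ρ + (⟦ (c , m) ∷ p ⟧ᴾ ρ + ⟦ r ⟧ᴾ ρ)       ≈⟨ x∙yz≈y∙xz _ _ _ ⟩
        ⟦ (c , m) ∷ p ⟧ᴾ ρ + (⟦ d , k ⟧ᵀ ρ + ⟦ r ⟧ᴾ ρ)       ∎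
      merge-sound {c = c} {d} {m} {k} {p} {r} (tri≈ _ m≋k _) _ ih _ with Pointwise-≡⇒≡ m≋k
      ... | ≡.refl = begin
        ⟦ (c ℤ.+ d , m) ∷? (p +ᴾ r) ⟧ᴾ ρ                          ≈⟨ ∷?-sound (c ℤ.+ d , m) (p +ᴾ r) ⟩
        fromℤ (c ℤ.+ d) * ⟦ m ⟧ᴹ ρ + ⟦ p +ᴾ r ⟧ᴾ ρ               ≈⟨ +-cong (*-congʳ (fromℤ-+ c d)) ih ⟩
        (fromℤ c + fromℤ d) * ⟦ m ⟧ᴹ ρ + (⟦ p ⟧ᴾ ρ + ⟦ r ⟧ᴾ ρ)    ≈⟨ +-congʳ (distribʳ _ _ _) ⟩
        ⟦ c , m ⟧ᵀ ρ + ⟦ d , m ⟧ᵀ ρ + (⟦ p ⟧ᴾ ρ + ⟦ r ⟧ᴾ ρ)       ≈⟨ +-interchange _ _ _ _ ⟩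
        ⟦ c , m ⟧ᵀ ρ + ⟦ p ⟧ᴾ ρ + (⟦ d , m ⟧ᵀ ρ + ⟦ r ⟧ᴾ ρ)       ∎

    +ᴾ-sound : ∀ p r → ⟦ p +ᴾ r ⟧ᴾ ρ ≈ ⟦ p ⟧ᴾ ρ + ⟦ r ⟧ᴾ ρ
    +ᴾ-sound []            r             = sym (+-identityˡ _)
    +ᴾ-sound (t ∷ p)       []            = sym (+-identityʳ _)
    +ᴾ-sound ((c , m) ∷ p) ((d , k) ∷ r) = merge-sound {p = p} {r} (compareᴹ m k)
      (+ᴾ-sound p ((d , k) ∷ r)) (+ᴾ-sound p r) (+ᴾ-sound ((c , m) ∷ p) r)

    *ᵀ-sound : ∀ t r → ⟦ t *ᵀ r ⟧ᴾ ρ ≈ ⟦ t ⟧ᵀ ρ * ⟦ r ⟧ᴾ ρ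
    *ᵀ-sound t             []            = sym (zeroʳ _)
    *ᵀ-sound t@(c , m) ((d , k) ∷ r) = begin
      fromℤ (c ℤ.* d) * ⟦ Vec.zipWith ℤ._+_ m k ⟧ᴹ ρ + ⟦ t *ᵀ r ⟧ᴾ ρ
        ≈⟨ +-cong (*-cong (fromℤ-* c d) (⟦*ᴹ⟧ m k ρ)) (*ᵀ-sound t r) ⟩
      fromℤ c * fromℤ d * (⟦ m ⟧ᴹ ρ * ⟦ k ⟧ᴹ ρ) + ⟦ t ⟧ᵀ ρ * ⟦ r ⟧ᴾ ρ
        ≈⟨ +-congʳ (interchange _ _ _ _) ⟩
      ⟦ t ⟧ᵀ ρ * ⟦ d , k ⟧ᵀ ρ + ⟦ t ⟧ᵀ ρ * ⟦ r ⟧ᴾ ρ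
        ≈⟨ distribˡ _ _ _ ⟨
      ⟦ t ⟧ᵀ ρ * (⟦ d , k ⟧ᵀ ρ + ⟦ r ⟧ᴾ ρ)
        ∎

    *ᴾ-sound : ∀ p r → ⟦ p *ᴾ r ⟧ᴾ ρ ≈ ⟦ p ⟧ᴾ ρ * ⟦ r ⟧ᴾ ρ
    *ᴾ-sound []      r = sym (zeroˡ _)
    *ᴾ-sound (t ∷ p) r = begin
      ⟦ t *ᵀ r +ᴾ p *ᴾ r ⟧ᴾ ρ                   ≈⟨ +ᴾ-sound (t *ᵀ r) (p *ᴾ r) ⟩
      ⟦ t *ᵀ r ⟧ᴾ ρ + ⟦ p *ᴾ r ⟧ᴾ ρ             ≈⟨ +-cong (*ᵀ-sound t r) (*ᴾ-sound p r) ⟩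
      ⟦ t ⟧ᵀ ρ * ⟦ r ⟧ᴾ ρ + ⟦ p ⟧ᴾ ρ * ⟦ r ⟧ᴾ ρ  ≈⟨ distribʳ _ _ _ ⟨
      (⟦ t ⟧ᵀ ρ + ⟦ p ⟧ᴾ ρ) * ⟦ r ⟧ᴾ ρ          ∎

    -ᴾ-sound : ∀ p → ⟦ -ᴾ p ⟧ᴾ ρ ≈ - ⟦ p ⟧ᴾ ρ
    -ᴾ-sound []            = sym ε⁻¹≈ε
    -ᴾ-sound ((c , m) ∷ p) = begin
      fromℤ (ℤ.- c) * ⟦ m ⟧ᴹ ρ + ⟦ -ᴾ p ⟧ᴾ ρ   ≈⟨ +-cong (*-congʳ (fromℤ-neg c)) (-ᴾ-sound p) ⟩
      - fromℤ c * ⟦ m ⟧ᴹ ρ + - ⟦ p ⟧ᴾ ρ         ≈⟨ +-congʳ (-‿distribˡ-* _ _) ⟨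
      - ⟦ c , m ⟧ᵀ ρ - ⟦ p ⟧ᴾ ρ                 ≈⟨ ⁻¹-∙-comm _ _ ⟩
      - (⟦ c , m ⟧ᵀ ρ + ⟦ p ⟧ᴾ ρ)               ∎

    ⟦_⟧¹ : ∀ m → ⟦ (+ 1 , m) ∷ [] ⟧ᴾ ρ ≈ ⟦ m ⟧ᴹ ρ
    ⟦ m ⟧¹ = trans (+-identityʳ _) (trans (*-congʳ (+-identityʳ 1#)) (*-identityˡ _))

    1ᴾ-sound : ⟦ 1ᴾ ⟧ᴾ ρ ≈ 1#
    1ᴾ-sound = trans ⟦ 1ᴹ ⟧¹ (⟦1ᴹ⟧ ρ)

    ^ᴾ-sound : ∀ p k → ⟦ p ^ᴾ k ⟧ᴾ ρ ≈ ⟦ p ⟧ᴾ ρ ^ k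
    ^ᴾ-sound p zero    = 1ᴾ-sound
    ^ᴾ-sound p (suc k) = trans (*ᴾ-sound p (p ^ᴾ k)) (*-congˡ (^ᴾ-sound p k))

    ⁻ᴾ-sound : ∀ p {p′} → p ⁻ᴾ ≡ just p′ → ⟦ p′ ⟧ᴾ ρ ≈ ⟦ p ⟧ᴾ ρ ⁻¹
    ⁻ᴾ-sound ((+ 1 , m) ∷ []) ≡.refl = sym (⁻¹-unique (begin
      ⟦ (+ 1 , m) ∷ [] ⟧ᴾ ρ * ⟦ (+ 1 , Vec.map ℤ.-_ m) ∷ [] ⟧ᴾ ρ
        ≈⟨ *-cong ⟦ m ⟧¹ ⟦ Vec.map ℤ.-_ m ⟧¹ ⟩
      ⟦ m ⟧ᴹ ρ * ⟦ Vec.map ℤ.-_ m ⟧ᴹ ρ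
        ≈⟨ trans (*-comm _ _) (⟦⁻ᴹ⟧ m ρ) ⟩
      1# ∎))
    ⁻ᴾ-sound ((-[1+ 0 ] , m) ∷ []) ≡.refl = sym (⁻¹-unique (begin
      ⟦ (-[1+ 0 ] , m) ∷ [] ⟧ᴾ ρ * ⟦ (-[1+ 0 ] , Vec.map ℤ.-_ m) ∷ [] ⟧ᴾ ρ
        ≈⟨ *-cong (+-identityʳ _) (+-identityʳ _) ⟩
      fromℤ -[1+ 0 ] * ⟦ m ⟧ᴹ ρ * (fromℤ -[1+ 0 ] * ⟦ Vec.map ℤ.-_ m ⟧ᴹ ρ)
        ≈⟨ interchange _ _ _ _ ⟩
      fromℤ -[1+ 0 ] * fromℤ -[1+ 0 ] * (⟦ m ⟧ᴹ ρ * ⟦ Vec.map ℤ.-_ m ⟧ᴹ ρ)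
        ≈⟨ *-cong (fromℤ-* -[1+ 0 ] -[1+ 0 ]) (*-comm _ _) ⟨
      fromℤ (+ 1) * (⟦ Vec.map ℤ.-_ m ⟧ᴹ ρ * ⟦ m ⟧ᴹ ρ)
        ≈⟨ *-cong (+-identityʳ 1#) (⟦⁻ᴹ⟧ m ρ) ⟩
      1# * 1#
        ≈⟨ *-identityˡ 1# ⟩
      1# ∎))

    normalise-sound : ∀ e {p} → normalise e ≡ just p → ⟦ p ⟧ᴾ ρ ≈ ⟦ e ⟧ ρ
    normalise-sound (var i)   ≡.refl = trans ⟦ unitᴹ (+ 1) i ⟧¹ (trans (⟦unitᴹ⟧ (+ 1) i ρ) (*-identityʳ _))
    normalise-sound (var⁻¹ i) ≡.refl = trans ⟦ unitᴹ -[1+ 0 ] i ⟧¹ (trans (⟦unitᴹ⟧ -[1+ 0 ] i ρ) (*-identityʳ _))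
    normalise-sound 1ₑ        ≡.refl = 1ᴾ-sound
    normalise-sound 0ₑ        ≡.refl = refl
    normalise-sound (e ⊕ f) eq with normalise e in eq₁ | normalise f in eq₂
    normalise-sound (e ⊕ f) ≡.refl | just p | just r =
      trans (+ᴾ-sound p r) (+-cong (normalise-sound e eq₁) (normalise-sound f eq₂))
    normalise-sound (e ⊗ f) eq with normalise e in eq₁ | normalise f in eq₂
    normalise-sound (e ⊗ f) ≡.refl | just p | just r =
      trans (*ᴾ-sound p r) (*-cong (normalise-sound e eq₁) (normalise-sound f eq₂))
    normalise-sound (e ⊖ f) eq with normalise e in eq₁ | normalise f in eq₂
    normalise-sound (e ⊖ f) ≡.refl | just p | just r =
      trans (+ᴾ-sound p (-ᴾ r)) (+-cong (normalise-sound e eq₁) (trans (-ᴾ-sound r) (-‿cong (normalise-sound f eq₂))))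
    normalise-sound (⊝ e) eq with normalise e in eq₁
    normalise-sound (⊝ e) ≡.refl | just p = trans (-ᴾ-sound p) (-‿cong (normalise-sound e eq₁))
    normalise-sound (e ⊛ k) eq with normalise e in eq₁
    normalise-sound (e ⊛ k) ≡.refl | just p = trans (^ᴾ-sound p k) (^-congˡ k (normalise-sound e eq₁))
    normalise-sound (e ⁻) eq with normalise e in eq₁
    normalise-sound (e ⁻) eq | just p = trans (⁻ᴾ-sound p eq) (⁻¹-cong (normalise-sound e eq₁))

    solve : ∀ e f → normalise (e ⊖ f) ≡ just [] → ⟦ e ⟧ ρ ≈ ⟦ f ⟧ ρ
    solve e f eq = begin
      ⟦ e ⟧ ρ                        ≈⟨ +-identityʳ _ ⟨
      ⟦ e ⟧ ρ + 0#                   ≈⟨ +-congˡ (-‿inverseˡ _) ⟨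
      ⟦ e ⟧ ρ + (- ⟦ f ⟧ ρ + ⟦ f ⟧ ρ) ≈⟨ +-assoc _ _ _ ⟨
      ⟦ e ⊖ f ⟧ ρ + ⟦ f ⟧ ρ          ≈⟨ +-congʳ (normalise-sound (e ⊖ f) eq) ⟨
      0# + ⟦ f ⟧ ρ                   ≈⟨ +-identityˡ _ ⟩
      ⟦ f ⟧ ρ                        ∎

    module _ (i : Fin n) (s s′ : Expr n)
             (value≈s : value (lookup ρ i) ≈ ⟦ s ⟧ ρ) (inverse≈s′ : inverse (lookup ρ i) ≈ ⟦ s′ ⟧ ρ) where

      substitute-sound : ∀ e → ⟦ e ⟧ ρ ≈ ⟦ e [ i ≔ s , s′ ] ⟧ ρ
      substitute-sound (var j) with i Fin.≟ j
      ... | yes ≡.refl = value≈s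
      ... | no _       = refl
      substitute-sound (var⁻¹ j) with i Fin.≟ j
      ... | yes ≡.refl = inverse≈s′
      ... | no _       = refl
      substitute-sound 1ₑ      = refl
      substitute-sound 0ₑ      = refl
      substitute-sound (e ⊕ f) = +-cong (substitute-sound e) (substitute-sound f)
      substitute-sound (e ⊗ f) = *-cong (substitute-sound e) (substitute-sound f)
      substitute-sound (e ⊖ f) = +-cong (substitute-sound e) (-‿cong (substitute-sound f))
      substitute-sound (⊝ e)   = -‿cong (substitute-sound e)
      substitute-sound (e ⊛ k) = ^-congˡ k (substitute-sound e)
      substitute-sound (e ⁻)   = ⁻¹-cong (substitute-sound e)

      solve-substituted : ∀ e f → normalise ((e ⊖ f) [ i ≔ s , s′ ]) ≡ just [] → ⟦ e ⟧ ρ ≈ ⟦ f ⟧ ρ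
      solve-substituted e f eq = begin
        ⟦ e ⟧ ρ                    ≈⟨ substitute-sound e ⟩
        ⟦ e [ i ≔ s , s′ ] ⟧ ρ     ≈⟨ solve (e [ i ≔ s , s′ ]) (f [ i ≔ s , s′ ]) eq ⟩
        ⟦ f [ i ≔ s , s′ ] ⟧ ρ     ≈⟨ substitute-sound f ⟨
        ⟦ f ⟧ ρ                    ∎

-- q-Pochhammer symbols, telescoping sums and recurrences

module Factorisations {c ℓ : Level} (F : Field c ℓ) where
  open Field F hiding (zero)
  open FieldOps F
  open FieldProperties F
  open SetoidReasoning setoid

  infixl 5 _⊠_
  _⊠_ : ∀ {x y u v u′ v′} → x ≈ u * v → y ≈ u′ * v′ → x * y ≈ (u * u′) * (v * v′)
  x≈uv ⊠ y≈u′v′ = trans (*-cong x≈uv y≈u′v′) (interchange _ _ _ _)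

  ÷-by-factorisations : ∀ {N D y C E f g} → N ≈ C * f → E ≈ D * g → ¬ E ≈ 0# →
                        N ÷ D * y ≈ C * E ⁻¹ * (f * g * y)
  ÷-by-factorisations {N} {D} {y} {C} {E} {f} {g} N≈Cf E≈Dg E≉0 = begin
    N * D ⁻¹ * y                 ≈⟨ *-congʳ (*-cong N≈Cf D⁻¹≈gE⁻¹) ⟩
    C * f * (g * E ⁻¹) * y       ≈⟨ *-congʳ (*-congˡ (*-comm g (E ⁻¹))) ⟩
    C * f * (E ⁻¹ * g) * y       ≈⟨ *-congʳ (interchange C f (E ⁻¹) g) ⟩
    C * E ⁻¹ * (f * g) * y       ≈⟨ *-assoc _ _ _ ⟩
    C * E ⁻¹ * (f * g * y)       ∎
    where
    D⁻¹≈gE⁻¹ : D ⁻¹ ≈ g * E ⁻¹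
    D⁻¹≈gE⁻¹ = ⁻¹-unique (begin
      D * (g * E ⁻¹)   ≈⟨ *-assoc _ _ _ ⟨
      D * g * E ⁻¹     ≈⟨ *-congʳ E≈Dg ⟨
      E * E ⁻¹         ≈⟨ *-inverse E≉0 ⟩
      1#               ∎)

  x≈x*1 : ∀ x → x ≈ x * 1#
  x≈x*1 x = sym (*-identityʳ x)

  *-assoc-factorisation : ∀ {x y u v} → x ≈ u * v → x * y ≈ u * (v * y)
  *-assoc-factorisation x≈uv = trans (*-congʳ x≈uv) (*-assoc _ _ _)

  +-factorisation : ∀ {C x y u v} → x ≈ C * u → y ≈ C * v → x + y ≈ C * (u + v)
  +-factorisation x≈Cu y≈Cv = trans (+-cong x≈Cu y≈Cv) (sym (distribˡ _ _ _))

  factor-out : ∀ {C x y z t u v w s d e} →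
               x ≈ C * u → y ≈ C * v → z ≈ C * w → t ≈ C * s →
               d * u - e * v ≈ w - s → d * x - e * y ≈ z - t
  factor-out {C} {x} {y} {z} {t} {u} {v} {w} {s} {d} {e} x≈Cu y≈Cv z≈Cw t≈Cs uv≈ws = begin
    d * x - e * y                ≈⟨ +-cong (*-congˡ x≈Cu) (-‿cong (*-congˡ y≈Cv)) ⟩
    d * (C * u) - e * (C * v)    ≈⟨ +-cong (x∙yz≈y∙xz d C u) (-‿cong (x∙yz≈y∙xz e C v)) ⟩
    C * (d * u) - C * (e * v)    ≈⟨ x[y-z]≈xy-xz C _ _ ⟨
    C * (d * u - e * v)          ≈⟨ *-congˡ uv≈ws ⟩
    C * (w - s)                  ≈⟨ x[y-z]≈xy-xz C w s ⟩
    C * w - C * s                ≈⟨ +-cong (sym z≈Cw) (-‿cong (sym t≈Cs)) ⟩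
    z - t                        ∎
    where
    open CommutativeSemigroupProperties *-commutativeSemigroup using (x∙yz≈y∙xz)
    open RingProperties ring using (x[y-z]≈xy-xz)

module Pochhammer {c ℓ : Level} (F : Field c ℓ) where
  open Field F hiding (zero)
  open FieldOps F
  open FieldProperties F
  open SetoidReasoning setoid

  poch-congˡ : ∀ {x y} Q k → x ≈ y → poch x Q k ≈ poch y Q k
  poch-congˡ Q zero    x≈y = refl
  poch-congˡ Q (suc k) x≈y = *-cong (poch-congˡ Q k x≈y) (+-congˡ (-‿cong (*-congʳ x≈y)))

  poch-suc : ∀ x Q k → poch x Q (suc k) ≈ (1# - x) * poch (x * Q) Q k
  poch-suc x Q zero = begin
    1# * (1# - x * 1#)   ≈⟨ *-identityˡ _ ⟩
    1# - x * 1#          ≈⟨ +-congˡ (-‿cong (*-identityʳ x)) ⟩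
    1# - x               ≈⟨ *-identityʳ _ ⟨
    (1# - x) * 1#        ∎
  poch-suc x Q (suc k) = begin
    poch x Q (suc k) * (1# - x * (Q * Q ^ k))
      ≈⟨ *-cong (poch-suc x Q k) (+-congˡ (-‿cong (sym (*-assoc x Q (Q ^ k))))) ⟩
    (1# - x) * poch (x * Q) Q k * (1# - x * Q * Q ^ k)
      ≈⟨ *-assoc _ _ _ ⟩
    (1# - x) * (poch (x * Q) Q k * (1# - x * Q * Q ^ k))
      ∎

  poch-suc′ : ∀ {x y} Q k → x * Q ≈ y → poch x Q (suc k) ≈ poch y Q k * (1# - x)
  poch-suc′ {x} Q k xQ≈y = trans (poch-suc x Q k) (trans (*-congˡ (poch-congˡ Q k xQ≈y)) (*-comm _ _))

  poch-≉0-≤ : ∀ x Q {k m} → k ≤ m → ¬ poch x Q m ≈ 0# → ¬ poch x Q k ≈ 0#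
  poch-≉0-≤ x Q {m = zero}  z≤n ≉0 = ≉0
  poch-≉0-≤ x Q {m = suc m} k≤m ≉0 with ℕ.m≤n⇒m<n∨m≡n k≤m
  ... | inj₂ ≡.refl       = ≉0
  ... | inj₁ (s≤s k≤m′)   = poch-≉0-≤ x Q k≤m′ (≉0-*ˡ ≉0)

  poch-factor-≉0 : ∀ x Q {i m} → i < m → ¬ poch x Q m ≈ 0# → ¬ 1# - x * Q ^ i ≈ 0#
  poch-factor-≉0 x Q i<m ≉0 = ≉0-*ʳ (poch-≉0-≤ x Q i<m ≉0)

  2*suc : ∀ n → 2 ℕ.* suc n ≡ suc (suc (2 ℕ.* n))
  2*suc n = ℕ.*-suc 2 n

  ^-2*suc : ∀ x n → x ^ (2 ℕ.* suc n) ≈ x * (x * x ^ (2 ℕ.* n))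
  ^-2*suc x n = ≡.subst (λ m → x ^ m ≈ x * (x * x ^ (2 ℕ.* n))) (≡.sym (2*suc n)) refl

  ^-square : ∀ x n → (x * x) ^ n ≈ x ^ (2 ℕ.* n)
  ^-square x zero    = refl
  ^-square x (suc n) = begin
    x * x * (x * x) ^ n        ≈⟨ *-congˡ (^-square x n) ⟩
    x * x * x ^ (2 ℕ.* n)      ≈⟨ *-assoc _ _ _ ⟩
    x * (x * x ^ (2 ℕ.* n))    ≈⟨ ^-2*suc x n ⟨
    x ^ (2 ℕ.* suc n)          ∎

  ^-double : ∀ x n → x ^ (2 ℕ.* n) ≈ x ^ n * x ^ n
  ^-double x n = trans (^-homo-* x n (n ℕ.+ 0)) (*-congˡ (reflexive (≡.cong (x ^_) (ℕ.+-identityʳ n))))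

  poch-square-base : ∀ x q n → poch x (q * q) (suc n) ≈ poch x (q * q) n * (1# - x * q ^ (2 ℕ.* n))
  poch-square-base x q n = *-congˡ (+-congˡ (-‿cong (*-congˡ (^-square q n))))

  poch-double : ∀ x q n → poch x q (2 ℕ.* suc n)
                ≈ poch x q (2 ℕ.* n) * ((1# - x * q ^ (2 ℕ.* n)) * (1# - x * (q * q ^ (2 ℕ.* n))))
  poch-double x q n = ≡.subst (λ m → poch x q m ≈ rhs) (≡.sym (2*suc n)) (*-assoc _ _ _)
    where
    rhs : Carrier
    rhs = poch x q (2 ℕ.* n) * ((1# - x * q ^ (2 ℕ.* n)) * (1# - x * (q * q ^ (2 ℕ.* n))))

module Sums {c ℓ : Level} (F : Field c ℓ) where
  open Field F hiding (zero)
  open FieldOps F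
  open SetoidReasoning setoid
  open import Algebra.Properties.AbelianGroup +-abelianGroup using (⁻¹-∙-comm)
  open CommutativeSemigroupProperties +-commutativeSemigroup using () renaming (interchange to +-interchange)

  *-sub-*-+ : ∀ d v x y u w → d * (x + u) - v * (y + w) ≈ (d * x - v * y) + (d * u - v * w)
  *-sub-*-+ d v x y u w = begin
    d * (x + u) - v * (y + w)                ≈⟨ +-cong (distribˡ d x u) (-‿cong (distribˡ v y w)) ⟩
    d * x + d * u - (v * y + v * w)          ≈⟨ +-congˡ (⁻¹-∙-comm _ _) ⟨
    d * x + d * u + (- (v * y) - v * w)      ≈⟨ +-interchange _ _ _ _ ⟩
    (d * x - v * y) + (d * u - v * w)        ∎

  telescope : ∀ x y z → (y - x) + (z - y) ≈ z - x
  telescope x y z = begin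
    (y - x) + (z - y)       ≈⟨ +-comm _ _ ⟩
    (z - y) + (y - x)       ≈⟨ +-assoc _ _ _ ⟩
    z + (- y + (y - x))     ≈⟨ +-congˡ (+-assoc _ _ _) ⟨
    z + (- y + y - x)       ≈⟨ +-congˡ (+-congʳ (-‿inverseˡ y)) ⟩
    z + (0# - x)            ≈⟨ +-congˡ (+-identityˡ _) ⟩
    z - x                   ∎

  creative-telescoping : ∀ (f g G : ℕ → Carrier) δ ν m →
    (∀ k → k ≤ m → δ * f k - ν * g k ≈ G (suc k) - G k) →
    δ * sumTo m f - ν * sumTo m g ≈ G (suc m) - G 0
  creative-telescoping f g G δ ν zero    local = local 0 z≤n
  creative-telescoping f g G δ ν (suc m) local = begin
    δ * (sumTo m f + f (suc m)) - ν * (sumTo m g + g (suc m))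
      ≈⟨ *-sub-*-+ δ ν _ _ _ _ ⟩
    (δ * sumTo m f - ν * sumTo m g) + (δ * f (suc m) - ν * g (suc m))
      ≈⟨ +-cong (creative-telescoping f g G δ ν m (λ k k≤m → local k (ℕ.m≤n⇒m≤1+n k≤m)))
                (local (suc m) ℕ.≤-refl) ⟩
    (G (suc m) - G 0) + (G (suc (suc m)) - G (suc m))
      ≈⟨ telescope _ _ _ ⟩
    G (suc (suc m)) - G 0
      ∎

  zeilberger-recurrence : ∀ (f g G : ℕ → Carrier) δ ν n → G 0 ≈ 0# →
    (∀ k → k < n → δ * f k - ν * g k ≈ G (suc k) - G k) →
    δ * (f n + f (suc n)) - ν * g n ≈ 0# - G n →
    δ * sumTo (suc n) f ≈ ν * sumTo n g
  zeilberger-recurrence f g G δ ν n G0≈0 local top = x∙y⁻¹≈ε⇒x≈y _ _ (begin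
    δ * sumTo (suc n) f - ν * sumTo n g   ≈⟨ difference n local top ⟩
    0# - G 0                              ≈⟨ +-congˡ (-‿cong G0≈0) ⟩
    0# - 0#                               ≈⟨ -‿inverseʳ 0# ⟩
    0#                                    ∎)
    where
    open import Algebra.Properties.Group +-group using (x∙y⁻¹≈ε⇒x≈y)
    difference : ∀ n → (∀ k → k < n → δ * f k - ν * g k ≈ G (suc k) - G k) →
                 δ * (f n + f (suc n)) - ν * g n ≈ 0# - G n →
                 δ * sumTo (suc n) f - ν * sumTo n g ≈ 0# - G 0
    difference zero    _     top = top
    difference (suc m) local top = begin
      δ * (sumTo m f + f (suc m) + f (suc (suc m))) - ν * (sumTo m g + g (suc m))
        ≈⟨ +-congʳ (*-congˡ (+-assoc _ _ _)) ⟩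
      δ * (sumTo m f + (f (suc m) + f (suc (suc m)))) - ν * (sumTo m g + g (suc m))
        ≈⟨ *-sub-*-+ δ ν _ _ _ _ ⟩
      (δ * sumTo m f - ν * sumTo m g) + (δ * (f (suc m) + f (suc (suc m))) - ν * g (suc m))
        ≈⟨ +-cong (creative-telescoping f g G δ ν m (λ k k≤m → local k (s≤s k≤m))) top ⟩
      (G (suc m) - G 0) + (0# - G (suc m))
        ≈⟨ telescope _ _ _ ⟩
      0# - G 0
        ∎

module Recurrences {c ℓ : Level} (R : CommutativeRing c ℓ) where
  open CommutativeRing R
  open SetoidReasoning setoid
  open CommutativeSemigroupProperties *-commutativeSemigroup using (x∙yz≈y∙xz)

  first-order-recurrence : ∀ {p} (P : ℕ → Set p) (S D N δ ν : ℕ → Carrier) →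
    (∀ n → P (suc n) → P n) →
    D 0 * S 0 ≈ N 0 →
    (∀ n → D (suc n) ≈ D n * δ n) →
    (∀ n → N (suc n) ≈ N n * ν n) →
    (∀ n → P (suc n) → δ n * S (suc n) ≈ ν n * S n) →
    ∀ n → P n → D n * S n ≈ N n
  first-order-recurrence P S D N δ ν P-pred base D-step N-step S-step = go
    where
    go : ∀ n → P n → D n * S n ≈ N n
    go zero    _  = base
    go (suc n) Pn = begin
      D (suc n) * S (suc n)       ≈⟨ *-congʳ (D-step n) ⟩
      D n * δ n * S (suc n)       ≈⟨ *-assoc _ _ _ ⟩
      D n * (δ n * S (suc n))     ≈⟨ *-congˡ (S-step n Pn) ⟩
      D n * (ν n * S n)           ≈⟨ x∙yz≈y∙xz _ _ _ ⟩
      ν n * (D n * S n)           ≈⟨ *-congˡ (go n (P-pred n Pn)) ⟩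
      ν n * N n                   ≈⟨ *-comm _ _ ⟩
      N n * ν n                   ≈⟨ N-step n ⟨
      N (suc n)                   ∎

-- The certificate as Laurent polynomial syntax in the atoms q, a, b, X = q^(2n), Y = q^(2j).
-- A cofactor `cofactor fs gs y` stands for fs₁ ⋯ fsᵢ · gs₁ ⋯ gsⱼ · y: the numerator factors of a
-- term beyond the common numerator, the factors of the common denominator missing from its own
-- denominator, and its power of q².  Each one is written so that its evaluation is literally the
-- cofactor produced by the ⊠-factorisations in Summation.
module Certificate where

  iq ia ib iX iY : Fin 5
  iq = zero
  ia = suc zero
  ib = suc (suc zero)
  iX = suc (suc (suc zero))
  iY = suc (suc (suc (suc zero)))

  q a b X Y q⁻¹ a⁻¹ b⁻¹ X⁻¹ Y⁻¹ : Expr 5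
  q   = var iq
  a   = var ia
  b   = var ib
  X   = var iX
  Y   = var iY
  q⁻¹ = var⁻¹ iq
  a⁻¹ = var⁻¹ ia
  b⁻¹ = var⁻¹ ib
  X⁻¹ = var⁻¹ iX
  Y⁻¹ = var⁻¹ iY

  Q QY : Expr 5
  Q  = q ⊗ q
  QY = Q ⊗ Y

  α₂ α₃ α₄ α₅ β₁ β₂ β₃ : Expr 5
  α₂ = ⊝ (a ⊗ Q ⊗ b⁻¹)
  α₃ = a ⊗ a ⊗ Q ⊗ (b ⊛ 4) ⁻
  α₄ = ⊝ (a ⊗ (q ⊗ X))
  α₅ = a ⊗ q ⊗ b⁻¹
  β₁ = a ⊗ a ⊗ (q ⊗ (q ⊗ X)) ⊗ (b ⊗ b) ⁻
  β₂ = ⊝ (a ⊗ q ⊗ X⁻¹ ⊗ (b ⊗ b) ⁻)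
  β₃ = ⊝ (a ⊗ b⁻¹)

  ⟨1-_⟩ : Expr 5 → Expr 5
  ⟨1- x ⟩ = 1ₑ ⊖ x

  ⟨1-_·_⟩ : Expr 5 → Expr 5 → Expr 5
  ⟨1- x · y ⟩ = 1ₑ ⊖ x ⊗ y

  κ : Expr 5
  κ = ⟨1- ⊝ (b ⊗ b ⊗ (a ⊗ q) ⁻) · 1ₑ ⟩

  ∏ : List (Expr 5) → Expr 5
  ∏ []       = 1ₑ
  ∏ (e ∷ es) = foldl _⊗_ e es

  cofactor : List (Expr 5) → List (Expr 5) → Expr 5 → Expr 5
  cofactor fs gs y = ∏ fs ⊗ ∏ gs ⊗ y

  δ ν : Expr 5
  δ = ⟨1- b ⊗ b · X ⟩ ⊗ ⟨1- ⊝ (b ⊗ b ⊗ (a ⊗ q) ⁻) · X ⟩ ⊗ (⟨1- α₅ · X ⟩ ⊗ ⟨1- α₅ · (q ⊗ X) ⟩)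
      ⊗ (⟨1- β₃ · X ⟩ ⊗ ⟨1- β₃ · (q ⊗ X) ⟩)
  ν = ⟨1- ⊝ (a ⊗ q ⊗ (b ⊗ b) ⁻) · X ⟩ ⊗ ⟨1- a ⊗ a ⊗ Q ⊗ (b ⊗ b) ⁻ · X ⟩ ⊗ (⟨1- b · X ⟩ ⊗ ⟨1- b · (q ⊗ X) ⟩)
      ⊗ (⟨1- ⊝ (b ⊗ q⁻¹) · X ⟩ ⊗ ⟨1- ⊝ (b ⊗ q⁻¹) · (q ⊗ X) ⟩)

  certificate : Expr 5 → Expr 5
  certificate y =
    ⟨1- a ⊗ a ⊗ Q ⊗ X ⊗ (b ⊗ b) ⁻ ⟩ ⊗ X ⊗ (1ₑ ⊕ a ⊗ q ⊗ (X ⊗ X)) ⊗ (P₀ ⊕ P₁ ⊗ y ⊕ P₂ ⊗ (y ⊗ y))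
      ⊗ ((1ₑ ⊕ a ⊗ q ⊗ X⁻¹ ⊗ (b ⊗ b) ⁻) ⊗ (a ⊗ q) ⁻)
    where
    W P₀ P₁ P₂ : Expr 5
    W  = ⟨1- a ⊗ q ⊗ (X ⊗ X) ⟩
    P₀ = (q⁻¹ ⊗ a⁻¹ ⊗ b ⊛ 4 ⊕ b ⊛ 2) ⊗ W
       ⊕ (⊝ (q⁻¹ ⊗ a⁻¹ ⊗ b ⊛ 6) ⊕ q⁻¹ ⊗ b ⊛ 3 ⊕ q⁻¹ ⊗ a ⊗ b ⊛ 2 ⊖ q ⊗ b ⊛ 3) ⊗ X
    P₁ = (⊝ (q⁻¹ ⊛ 3 ⊗ a ⊗ b ⊛ 2) ⊖ q⁻¹ ⊛ 2 ⊗ b ⊛ 4 ⊕ q⁻¹ ⊛ 2 ⊗ a ⊗ b ⊕ q⁻¹ ⊗ b ⊛ 3) ⊗ W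
       ⊕ (⊝ (q⁻¹ ⊛ 3 ⊗ b ⊛ 5) ⊕ q⁻¹ ⊛ 2 ⊗ b ⊛ 4 ⊕ q⁻¹ ⊗ a ⊛ 2 ⊗ b ⊖ a ⊛ 2) ⊗ X
    P₂ = (⊝ (q⁻¹ ⊛ 4 ⊗ a ⊗ b ⊛ 3) ⊖ q⁻¹ ⊛ 3 ⊗ a ⊛ 2 ⊗ b) ⊗ W
       ⊕ (⊝ (q⁻¹ ⊛ 4 ⊗ a ⊛ 2 ⊗ b ⊛ 2) ⊕ q⁻¹ ⊛ 2 ⊗ a ⊗ b ⊛ 3 ⊕ q⁻¹ ⊛ 2 ⊗ a ⊛ 2 ⊗ b ⊛ 2
          ⊖ q⁻¹ ⊛ 2 ⊗ a ⊛ 3 ⊗ b⁻¹) ⊗ X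

  interior-next interior-curr interior-upper interior-lower : Expr 5
  interior-next = cofactor
    (⟨1- q⁻¹ ⊗ (q⁻¹ ⊗ X⁻¹) ⟩ ∷ 1ₑ ∷ 1ₑ ∷ ⟨1- α₄ · Y ⟩ ∷ 1ₑ ∷ [])
    (⟨1- β₁ ⟩ ∷ ⟨1- β₂ · QY ⟩ ∷ ⟨1- β₃ · QY ⟩ ⊗ ⟨1- β₃ · (Q ⊗ QY) ⟩ ∷ ⟨1- α₅ · QY ⟩ ∷ 1ₑ ∷ κ ∷ [])
    QY
  interior-curr = cofactor
    (⟨1- X⁻¹ · Y ⟩ ∷ 1ₑ ∷ 1ₑ ∷ ⟨1- ⊝ (a ⊗ X ⊗ q⁻¹) ⟩ ∷ 1ₑ ∷ [])
    (⟨1- β₁ · QY ⟩ ∷ ⟨1- β₂ ⟩ ∷ ⟨1- β₃ · QY ⟩ ⊗ ⟨1- β₃ · (Q ⊗ QY) ⟩ ∷ ⟨1- α₅ · QY ⟩ ∷ 1ₑ ∷ κ ∷ [])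
    QY
  interior-upper = cofactor
    (⟨1- X⁻¹ · Y ⟩ ∷ ⟨1- α₂ · QY ⟩ ∷ ⟨1- α₃ · QY ⟩ ∷ ⟨1- α₄ · Y ⟩ ∷ ⟨1- α₅ · QY ⟩ ∷ [])
    (1ₑ ∷ 1ₑ ∷ 1ₑ ∷ 1ₑ ∷ 1ₑ ∷ 1ₑ ∷ [])
    (certificate (Q ⊗ QY))
  interior-lower = cofactor
    (1ₑ ∷ 1ₑ ∷ 1ₑ ∷ 1ₑ ∷ 1ₑ ∷ [])
    (⟨1- β₁ · QY ⟩ ∷ ⟨1- β₂ · QY ⟩ ∷ ⟨1- β₃ · (Q ⊗ QY) ⟩ ∷ ⟨1- α₅ · QY ⟩ ∷ ⟨1- QY ⟩ ∷ 1ₑ ∷ [])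
    (certificate QY)

  initial-term initial-upper : Expr 5
  initial-term = cofactor
    (1ₑ ∷ 1ₑ ∷ 1ₑ ∷ 1ₑ ∷ 1ₑ ∷ [])
    (⟨1- β₁ · 1ₑ ⟩ ∷ ⟨1- β₂ · 1ₑ ⟩ ∷ ⟨1- β₃ · 1ₑ ⟩ ⊗ ⟨1- β₃ · (Q ⊗ 1ₑ) ⟩ ∷ ⟨1- α₅ · 1ₑ ⟩ ∷ 1ₑ ∷ κ ∷ [])
    1ₑ
  initial-upper = cofactor
    (1ₑ ∷ ⟨1- α₂ · 1ₑ ⟩ ∷ ⟨1- α₃ · 1ₑ ⟩ ∷ 1ₑ ∷ ⟨1- α₅ · 1ₑ ⟩ ∷ [])
    (1ₑ ∷ 1ₑ ∷ 1ₑ ∷ 1ₑ ∷ 1ₑ ∷ 1ₑ ∷ [])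
    (certificate (Q ⊗ 1ₑ))

  boundary-next boundary-next′ boundary-curr boundary-lower : Expr 5
  boundary-next = cofactor
    (⟨1- q⁻¹ ⊗ (q⁻¹ ⊗ X⁻¹) ⟩ ∷ 1ₑ ∷ 1ₑ ∷ ⟨1- α₄ · Y ⟩ ∷ 1ₑ ∷ [])
    (⟨1- β₁ ⟩ ⊗ ⟨1- β₁ ⊗ Q · QY ⟩ ∷ ⟨1- β₂ · QY ⟩ ∷ ⟨1- β₃ · QY ⟩ ∷ ⟨1- α₅ · QY ⟩ ∷ ⟨1- Q ⊗ QY ⟩ ∷ κ ∷ [])
    QY
  boundary-next′ = cofactor
    (⟨1- q⁻¹ ⊗ (q⁻¹ ⊗ X⁻¹) ⟩ ⊗ ⟨1- X⁻¹ · Y ⟩ ∷ ⟨1- α₂ · QY ⟩ ∷ ⟨1- α₃ · QY ⟩ ∷ ⟨1- α₄ · Y ⟩ ⊗ ⟨1- α₄ · QY ⟩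
      ∷ ⟨1- α₅ · QY ⟩ ∷ [])
    (⟨1- β₁ ⟩ ∷ 1ₑ ∷ 1ₑ ∷ 1ₑ ∷ 1ₑ ∷ κ ∷ [])
    (Q ⊗ QY)
  boundary-curr = cofactor
    (⟨1- X⁻¹ · Y ⟩ ∷ 1ₑ ∷ 1ₑ ∷ ⟨1- ⊝ (a ⊗ X ⊗ q⁻¹) ⟩ ∷ 1ₑ ∷ [])
    (⟨1- β₁ · QY ⟩ ⊗ ⟨1- β₁ · (Q ⊗ QY) ⟩ ∷ ⟨1- β₂ ⟩ ∷ ⟨1- β₃ · QY ⟩ ∷ ⟨1- α₅ · QY ⟩ ∷ ⟨1- Q ⊗ QY ⟩ ∷ κ ∷ [])
    QY
  boundary-lower = cofactor
    (1ₑ ∷ 1ₑ ∷ 1ₑ ∷ 1ₑ ∷ 1ₑ ∷ [])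
    (⟨1- β₁ · QY ⟩ ⊗ ⟨1- β₁ · (Q ⊗ QY) ⟩ ∷ ⟨1- β₂ · QY ⟩ ∷ 1ₑ ∷ ⟨1- α₅ · QY ⟩ ∷ ⟨1- QY ⟩ ⊗ ⟨1- Q ⊗ QY ⟩ ∷ 1ₑ ∷ [])
    (certificate QY)

  boundary₀-term boundary₀-next′ : Expr 5
  boundary₀-term = cofactor
    (1ₑ ∷ 1ₑ ∷ 1ₑ ∷ 1ₑ ∷ 1ₑ ∷ [])
    (⟨1- a ⊗ a ⊗ (q ⊗ (q ⊗ (q ⊗ (q ⊗ 1ₑ)))) ⊗ (b ⊗ b) ⁻ · 1ₑ ⟩
      ∷ ⟨1- ⊝ (a ⊗ q ⊛ 3 ⊗ (q⁻¹ ⊗ (q⁻¹ ⊗ 1ₑ)) ⊗ (b ⊗ b) ⁻) · 1ₑ ⟩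
      ∷ ⟨1- β₃ · 1ₑ ⟩ ∷ ⟨1- α₅ · 1ₑ ⟩ ∷ ⟨1- Q · 1ₑ ⟩ ∷ κ ∷ [])
    1ₑ
  boundary₀-next′ = cofactor
    (⟨1- q⁻¹ ⊗ (q⁻¹ ⊗ 1ₑ) · 1ₑ ⟩ ∷ ⟨1- α₂ · 1ₑ ⟩ ∷ ⟨1- α₃ · 1ₑ ⟩ ∷ ⟨1- ⊝ (a ⊗ (q ⊗ (q ⊗ 1ₑ)) ⊗ q⁻¹) · 1ₑ ⟩
      ∷ ⟨1- α₅ · 1ₑ ⟩ ∷ [])
    (1ₑ ∷ 1ₑ ∷ 1ₑ ∷ 1ₑ ∷ 1ₑ ∷ κ ∷ [])
    (Q ⊗ 1ₑ)

  interior-identity :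
    normalise (δ ⊗ interior-next ⊖ ν ⊗ interior-curr ⊖ (interior-upper ⊖ interior-lower)) ≡ just []
  interior-identity = ≡.refl

  initial-identity :
    normalise (δ ⊗ initial-term ⊖ ν ⊗ initial-term ⊖ (initial-upper ⊖ 0ₑ)) ≡ just []
  initial-identity = ≡.refl

  boundary-identity :
    normalise ((δ ⊗ (boundary-next ⊕ boundary-next′) ⊖ ν ⊗ boundary-curr ⊖ (0ₑ ⊖ boundary-lower))
                 [ iX ≔ QY , q⁻¹ ⊗ q⁻¹ ⊗ Y⁻¹ ])
      ≡ just []
  boundary-identity = ≡.refl

  boundary₀-identity :
    normalise ((δ ⊗ (boundary₀-term ⊕ boundary₀-next′) ⊖ ν ⊗ boundary₀-term ⊖ (0ₑ ⊖ 0ₑ)) [ iX ≔ 1ₑ , 1ₑ ])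
      ≡ just []
  boundary₀-identity = ≡.refl

module Summation {c ℓ : Level} (F : Field c ℓ) (q a b : Field.Carrier F)
                 (q≉0 : ¬ Field._≈_ F q (Field.0# F)) (a≉0 : ¬ Field._≈_ F a (Field.0# F))
                 (b≉0 : ¬ Field._≈_ F b (Field.0# F)) where
  open Field F hiding (zero)
  open FieldOps F hiding (⟦_⟧)
  open FieldProperties F
  open LaurentSemantics F
  open Factorisations F
  open Pochhammer F
  open Sums F
  open Recurrences commutativeRing
  module C = Certificate

  Q : Carrier
  Q = q * q

  α₁ α₄ α₄′ β₁ β₂ β₂′ : ℕ → Carrier
  α₁ n  = (q ⁻¹) ^ (2 ℕ.* n)
  α₄ n  = - (a * q ^ (2 ℕ.* n) * q ⁻¹)
  α₄′ n = - (a * (q * q ^ (2 ℕ.* n)))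
  β₁ n  = (a * a) * q ^ (2 ℕ.+ 2 ℕ.* n) ÷ (b * b)
  β₂ n  = - (a * q ^ 3 * (q ⁻¹) ^ (2 ℕ.* n) ÷ (b * b))
  β₂′ n = - (a * q * (q ⁻¹) ^ (2 ℕ.* n) ÷ (b * b))

  α₂ α₃ α₅ β₃ κ : Carrier
  α₂ = - (a * (q * q) ÷ b)
  α₃ = (a * a) * (q * q) ÷ b ^ 4
  α₅ = a * q ÷ b
  β₃ = - (a ÷ b)
  κ  = 1# - (- ((b * b) ÷ (a * q))) * 1#

  term : ℕ → ℕ → Carrier
  term n k = (poch (α₁ n) Q k * poch α₂ Q k * poch α₃ Q k * poch (α₄ n) Q k * poch α₅ Q k)
           ÷ (poch (β₁ n) Q k * poch (β₂ n) Q k * poch β₃ Q k * poch α₅ Q k * poch Q Q k)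
           * Q ^ k

  q*q⁻¹≈1 : q * q ⁻¹ ≈ 1#
  q*q⁻¹≈1 = *-inverse q≉0

  Q*Q⁻¹≈1 : Q * (q ⁻¹ * q ⁻¹) ≈ 1#
  Q*Q⁻¹≈1 = trans (interchange _ _ _ _) (trans (*-cong q*q⁻¹≈1 q*q⁻¹≈1) (*-identityˡ 1#))

  power : ∀ {x y} → x * y ≈ 1# → ℕ → Invertible
  power {x} {y} xy≈1 k = invertible (x ^ k) (y ^ k) (inverse-^ k xy≈1)

  env′ : ℕ → Invertible → Env 5
  env′ n Y = invertible q (q ⁻¹) q*q⁻¹≈1 ∷ invertible a (a ⁻¹) (*-inverse a≉0) ∷ invertible b (b ⁻¹) (*-inverse b≉0)
           ∷ power q*q⁻¹≈1 (2 ℕ.* n) ∷ Y ∷ []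

  env : ℕ → ℕ → Env 5
  env n j = env′ n (power Q*Q⁻¹≈1 j)

  G : ℕ → ℕ → Carrier
  G n zero    = 0#
  G n (suc j) =
    (poch (α₁ n) Q j * poch α₂ Q (suc j) * poch α₃ Q (suc j) * poch (α₄′ n) Q j * poch α₅ Q (suc j))
    ÷ (poch (β₁ n) Q (suc j) * poch (β₂′ n) Q (suc j) * poch β₃ Q (suc (suc j)) * poch α₅ Q (suc j)
       * poch Q Q j * κ)
    * ⟦ C.certificate C.QY ⟧ (env n j)

  δ ν : ℕ → Carrier
  δ n = ⟦ C.δ ⟧ (env n 0)
  ν n = ⟦ C.ν ⟧ (env n 0)

  Num Den : ℕ → Carrier
  Num n = poch (- (a * q ÷ (b * b))) Q n * poch ((a * a) * (q * q) ÷ (b * b)) Q n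
        * poch b q (2 ℕ.* n) * poch (- (b * q ⁻¹)) q (2 ℕ.* n)
  Den n = poch (b * b) Q n * poch (- ((b * b) ÷ (a * q))) Q n
        * poch (a * q ÷ b) q (2 ℕ.* n) * poch (- (a ÷ b)) q (2 ℕ.* n)

  Num-suc : ∀ n → Num (suc n) ≈ Num n * ν n
  Num-suc n = poch-square-base _ q n ⊠ poch-square-base _ q n ⊠ poch-double _ q n ⊠ poch-double _ q n

  Den-suc : ∀ n → Den (suc n) ≈ Den n * δ n
  Den-suc n = poch-square-base _ q n ⊠ poch-square-base _ q n ⊠ poch-double _ q n ⊠ poch-double _ q n

  α₁-shift : ∀ n → α₁ (suc n) * Q ≈ α₁ n
  α₁-shift n = trans (*-congʳ (^-2*suc (q ⁻¹) n))
    (solve (env n 0) (C.q⁻¹ ⊗ (C.q⁻¹ ⊗ C.X⁻¹) ⊗ C.Q) C.X⁻¹ ≡.refl)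

  α₁-suc : ∀ n → 1# - α₁ (suc n) ≈ 1# - q ⁻¹ * (q ⁻¹ * α₁ n)
  α₁-suc n = +-congˡ (-‿cong (^-2*suc (q ⁻¹) n))

  α₄-suc : ∀ n → α₄ (suc n) ≈ α₄′ n
  α₄-suc n = trans (-‿cong (*-congʳ (*-congˡ (^-2*suc q n))))
    (solve (env n 0) (⊝ (C.a ⊗ (C.q ⊗ (C.q ⊗ C.X)) ⊗ C.q⁻¹)) C.α₄ ≡.refl)

  α₄-shift : ∀ n → α₄ n * Q ≈ α₄′ n
  α₄-shift n = solve (env n 0) (⊝ (C.a ⊗ C.X ⊗ C.q⁻¹) ⊗ C.Q) C.α₄ ≡.refl

  β₁-shift : ∀ n → β₁ n * Q ≈ β₁ (suc n)
  β₁-shift n = trans (solve (env n 0) (C.β₁ ⊗ C.Q) β₁[n+1] ≡.refl)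
    (sym (*-congʳ (*-congˡ (*-congˡ (*-congˡ (^-2*suc q n))))))
    where
    β₁[n+1] : Expr 5
    β₁[n+1] = C.a ⊗ C.a ⊗ (C.q ⊗ (C.q ⊗ (C.q ⊗ (C.q ⊗ C.X)))) ⊗ (C.b ⊗ C.b) ⁻

  β₂-suc : ∀ n → β₂ (suc n) ≈ β₂′ n
  β₂-suc n = trans (-‿cong (*-congʳ (*-congˡ (^-2*suc (q ⁻¹) n))))
    (solve (env n 0) (⊝ (C.a ⊗ C.q ⊛ 3 ⊗ (C.q⁻¹ ⊗ (C.q⁻¹ ⊗ C.X⁻¹)) ⊗ (C.b ⊗ C.b) ⁻)) C.β₂ ≡.refl)

  β₂′-shift : ∀ n → β₂′ n * Q ≈ β₂ n
  β₂′-shift n = solve (env n 0) (C.β₂ ⊗ C.Q) (⊝ (C.a ⊗ C.q ⊛ 3 ⊗ C.X⁻¹ ⊗ (C.b ⊗ C.b) ⁻)) ≡.refl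

  module Interior (n j : ℕ) where
    num den : Carrier
    num = poch (α₁ n) Q j * poch α₂ Q (suc j) * poch α₃ Q (suc j) * poch (α₄′ n) Q j * poch α₅ Q (suc j)
    den = poch (β₁ n) Q (suc (suc j)) * poch (β₂′ n) Q (suc (suc j)) * poch β₃ Q (suc (suc (suc j)))
          * poch α₅ Q (suc (suc j)) * poch Q Q (suc j) * κ

    module _ (den≉0 : ¬ den ≈ 0#) where
      next : term (suc n) (suc j) ≈ num * den ⁻¹ * ⟦ C.interior-next ⟧ (env n j)
      next = ÷-by-factorisations
        (trans (poch-suc′ Q j (α₁-shift n)) (*-congˡ (α₁-suc n))
          ⊠ x≈x*1 _ ⊠ x≈x*1 _ ⊠ poch-congˡ Q (suc j) (α₄-suc n) ⊠ x≈x*1 _)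
        (*-assoc-factorisation (poch-suc′ Q (suc j) (β₁-shift n)
          ⊠ *-congʳ (poch-congˡ Q (suc j) (sym (β₂-suc n)))
          ⊠ *-assoc _ _ _ ⊠ refl ⊠ x≈x*1 _))
        den≉0

      curr : term n (suc j) ≈ num * den ⁻¹ * ⟦ C.interior-curr ⟧ (env n j)
      curr = ÷-by-factorisations
        (refl ⊠ x≈x*1 _ ⊠ x≈x*1 _ ⊠ poch-suc′ Q j (α₄-shift n) ⊠ x≈x*1 _)
        (*-assoc-factorisation (refl ⊠ poch-suc′ Q (suc j) (β₂′-shift n) ⊠ *-assoc _ _ _ ⊠ refl ⊠ x≈x*1 _))
        den≉0

      upper : G n (suc (suc j)) ≈ num * den ⁻¹ * ⟦ C.interior-upper ⟧ (env n j)
      upper = ÷-by-factorisations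
        (refl ⊠ refl ⊠ refl ⊠ refl ⊠ refl)
        (x≈x*1 _ ⊠ x≈x*1 _ ⊠ x≈x*1 _ ⊠ x≈x*1 _ ⊠ x≈x*1 _ ⊠ x≈x*1 _)
        den≉0

      lower : G n (suc j) ≈ num * den ⁻¹ * ⟦ C.interior-lower ⟧ (env n j)
      lower = ÷-by-factorisations
        (x≈x*1 _ ⊠ x≈x*1 _ ⊠ x≈x*1 _ ⊠ x≈x*1 _ ⊠ x≈x*1 _)
        (refl ⊠ refl ⊠ refl ⊠ refl ⊠ refl ⊠ x≈x*1 _)
        den≉0

      identity : δ n * term (suc n) (suc j) - ν n * term n (suc j) ≈ G n (suc (suc j)) - G n (suc j)
      identity = factor-out next curr upper lower
        (solve (env n j) (C.δ ⊗ C.interior-next ⊖ C.ν ⊗ C.interior-curr) (C.interior-upper ⊖ C.interior-lower)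
               C.interior-identity)

  module Initial (n : ℕ) where
    num den : Carrier
    num = poch (α₁ n) Q 0 * poch α₂ Q 0 * poch α₃ Q 0 * poch (α₄′ n) Q 0 * poch α₅ Q 0
    den = poch (β₁ n) Q 1 * poch (β₂′ n) Q 1 * poch β₃ Q 2 * poch α₅ Q 1 * poch Q Q 0 * κ

    module _ (den≉0 : ¬ den ≈ 0#) where
      first : ∀ n′ → term n′ 0 ≈ num * den ⁻¹ * ⟦ C.initial-term ⟧ (env n 0)
      first n′ = ÷-by-factorisations
        (x≈x*1 _ ⊠ x≈x*1 _ ⊠ x≈x*1 _ ⊠ x≈x*1 _ ⊠ x≈x*1 _)
        (*-assoc-factorisation (refl ⊠ refl ⊠ *-assoc _ _ _ ⊠ refl ⊠ x≈x*1 _))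
        den≉0

      upper : G n 1 ≈ num * den ⁻¹ * ⟦ C.initial-upper ⟧ (env n 0)
      upper = ÷-by-factorisations
        (x≈x*1 _ ⊠ refl ⊠ refl ⊠ x≈x*1 _ ⊠ refl)
        (x≈x*1 _ ⊠ x≈x*1 _ ⊠ x≈x*1 _ ⊠ x≈x*1 _ ⊠ x≈x*1 _ ⊠ x≈x*1 _)
        den≉0

      identity : δ n * term (suc n) 0 - ν n * term n 0 ≈ G n 1 - G n 0
      identity = factor-out (first (suc n)) (first n) upper (sym (zeroʳ _))
        (solve (env n 0) (C.δ ⊗ C.initial-term ⊖ C.ν ⊗ C.initial-term) (C.initial-upper ⊖ 0ₑ)
               C.initial-identity)

  module Boundary (m : ℕ) where
    n : ℕ
    n = suc m

    num den : Carrier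
    num = poch (α₁ n) Q m * poch α₂ Q (suc m) * poch α₃ Q (suc m) * poch (α₄′ n) Q m * poch α₅ Q (suc m)
    den = poch (β₁ n) Q (suc (suc (suc m))) * poch (β₂′ n) Q (suc (suc m)) * poch β₃ Q (suc (suc m))
          * poch α₅ Q (suc (suc m)) * poch Q Q (suc (suc m)) * κ

    module _ (den≉0 : ¬ den ≈ 0#) where
      open CommutativeSemigroupProperties *-commutativeSemigroup using (x∙yz≈y∙xz)

      next : term (suc n) n ≈ num * den ⁻¹ * ⟦ C.boundary-next ⟧ (env n m)
      next = ÷-by-factorisations
        (trans (poch-suc′ Q m (α₁-shift n)) (*-congˡ (α₁-suc n))
          ⊠ x≈x*1 _ ⊠ x≈x*1 _ ⊠ poch-congˡ Q (suc m) (α₄-suc n) ⊠ x≈x*1 _)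
        (*-assoc-factorisation
          (trans (poch-suc _ Q (suc (suc m))) (trans (*-congˡ (*-congʳ (poch-congˡ Q (suc m) (β₁-shift n))))
                                                      (x∙yz≈y∙xz _ _ _))
          ⊠ *-congʳ (poch-congˡ Q (suc m) (sym (β₂-suc n)))
          ⊠ refl ⊠ refl ⊠ refl))
        den≉0

      next′ : term (suc n) (suc n) ≈ num * den ⁻¹ * ⟦ C.boundary-next′ ⟧ (env n m)
      next′ = ÷-by-factorisations
        (trans (poch-suc _ Q (suc m)) (trans (*-cong (α₁-suc n) (poch-congˡ Q (suc m) (α₁-shift n)))
                                             (x∙yz≈y∙xz _ _ _))
          ⊠ refl ⊠ refl ⊠ trans (poch-congˡ Q (suc (suc m)) (α₄-suc n)) (*-assoc _ _ _) ⊠ refl)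
        (*-assoc-factorisation (poch-suc′ Q (suc (suc m)) (β₁-shift n)
          ⊠ trans (poch-congˡ Q (suc (suc m)) (sym (β₂-suc n))) (x≈x*1 _)
          ⊠ x≈x*1 _ ⊠ x≈x*1 _ ⊠ x≈x*1 _))
        den≉0

      curr : term n n ≈ num * den ⁻¹ * ⟦ C.boundary-curr ⟧ (env n m)
      curr = ÷-by-factorisations
        (refl ⊠ x≈x*1 _ ⊠ x≈x*1 _ ⊠ poch-suc′ Q m (α₄-shift n) ⊠ x≈x*1 _)
        (*-assoc-factorisation (*-assoc _ _ _ ⊠ poch-suc′ Q (suc m) (β₂′-shift n) ⊠ refl ⊠ refl ⊠ refl))
        den≉0

      lower : G n n ≈ num * den ⁻¹ * ⟦ C.boundary-lower ⟧ (env n m)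
      lower = ÷-by-factorisations
        (x≈x*1 _ ⊠ x≈x*1 _ ⊠ x≈x*1 _ ⊠ x≈x*1 _ ⊠ x≈x*1 _)
        (*-assoc _ _ _ ⊠ refl ⊠ x≈x*1 _ ⊠ refl ⊠ *-assoc _ _ _ ⊠ x≈x*1 _)
        den≉0

      -- Here q ^ (2 n) = q² · (q²) ^ m, which the normaliser learns by substituting q²Y for X.
      identity : δ n * (term (suc n) n + term (suc n) (suc n)) - ν n * term n n ≈ 0# - G n n
      identity = factor-out (+-factorisation next next′) curr (sym (zeroʳ _)) lower
        (solve-substituted (env n m) C.iX C.QY (C.q⁻¹ ⊗ C.q⁻¹ ⊗ C.Y⁻¹)
          (sym (^-square q n)) (sym (^-square (q ⁻¹) n))
          (C.δ ⊗ (C.boundary-next ⊕ C.boundary-next′) ⊖ C.ν ⊗ C.boundary-curr) (0ₑ ⊖ C.boundary-lower)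
          C.boundary-identity)

  module Boundary₀ where
    num den : Carrier
    num = poch (α₁ 0) Q 0 * poch α₂ Q 0 * poch α₃ Q 0 * poch (α₄′ 0) Q 0 * poch α₅ Q 0
    den = poch (β₁ 1) Q 1 * poch (β₂ 1) Q 1 * poch β₃ Q 1 * poch α₅ Q 1 * poch Q Q 1 * κ

    module _ (den≉0 : ¬ den ≈ 0#) where
      first : ∀ n → term n 0 ≈ num * den ⁻¹ * ⟦ C.boundary₀-term ⟧ (env 0 0)
      first n = ÷-by-factorisations
        (x≈x*1 _ ⊠ x≈x*1 _ ⊠ x≈x*1 _ ⊠ x≈x*1 _ ⊠ x≈x*1 _)
        (*-assoc-factorisation (refl ⊠ refl ⊠ refl ⊠ refl ⊠ refl))
        den≉0

      next′ : term 1 1 ≈ num * den ⁻¹ * ⟦ C.boundary₀-next′ ⟧ (env 0 0)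
      next′ = ÷-by-factorisations
        (refl ⊠ refl ⊠ refl ⊠ refl ⊠ refl)
        (*-assoc-factorisation (x≈x*1 _ ⊠ x≈x*1 _ ⊠ x≈x*1 _ ⊠ x≈x*1 _ ⊠ x≈x*1 _))
        den≉0

      identity : δ 0 * (term 1 0 + term 1 1) - ν 0 * term 0 0 ≈ 0# - G 0 0
      identity = factor-out (+-factorisation (first 1) next′) (first 0) (sym (zeroʳ _)) (sym (zeroʳ _))
        (solve-substituted (env 0 0) C.iX 1ₑ 1ₑ refl refl
          (C.δ ⊗ (C.boundary₀-term ⊕ C.boundary₀-next′) ⊖ C.ν ⊗ C.boundary₀-term) (0ₑ ⊖ 0ₑ)
          C.boundary₀-identity)

  β₁-factorisation : ∀ n → 1# - β₁ n ≈ (1# - α₅ * q ^ n) * (1# - β₃ * q ^ suc n)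
  β₁-factorisation n = solve-substituted (env′ n (power q*q⁻¹≈1 n)) C.iX (C.Y ⊗ C.Y) (C.Y⁻¹ ⊗ C.Y⁻¹)
    (^-double q n) (^-double (q ⁻¹) n) C.⟨1- C.β₁ ⟩ (C.⟨1- C.α₅ · C.Y ⟩ ⊗ C.⟨1- C.β₃ · (C.q ⊗ C.Y) ⟩) ≡.refl

  H₁ H₂ : ℕ → Set ℓ
  H₁ n = ¬ poch (β₁ n) Q n * poch (β₂ n) Q n * poch β₃ Q n * poch α₅ Q n * poch Q Q n ≈ 0#
  H₂ n = ¬ Den n ≈ 0#

  module NonVanishing (n : ℕ) (h₁ : H₁ (suc n)) (h₂ : H₂ (suc n)) where
    poch-β₁≉0 : ¬ poch (β₁ (suc n)) Q (suc n) ≈ 0#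
    poch-β₁≉0 = ≉0-*ˡ (≉0-*ˡ (≉0-*ˡ (≉0-*ˡ h₁)))
    poch-β₂≉0 : ¬ poch (β₂ (suc n)) Q (suc n) ≈ 0#
    poch-β₂≉0 = ≉0-*ʳ (≉0-*ˡ (≉0-*ˡ (≉0-*ˡ h₁)))
    poch-β₃≉0 : ¬ poch β₃ Q (suc n) ≈ 0#
    poch-β₃≉0 = ≉0-*ʳ (≉0-*ˡ (≉0-*ˡ h₁))
    poch-α₅≉0 : ¬ poch α₅ Q (suc n) ≈ 0#
    poch-α₅≉0 = ≉0-*ʳ (≉0-*ˡ h₁)
    poch-Q≉0 : ¬ poch Q Q (suc n) ≈ 0#
    poch-Q≉0 = ≉0-*ʳ h₁
    poch-b²≉0 : ¬ poch (b * b) Q (suc n) ≈ 0#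
    poch-b²≉0 = ≉0-*ˡ (≉0-*ˡ (≉0-*ˡ h₂))
    poch-κ≉0 : ¬ poch (- ((b * b) ÷ (a * q))) Q (suc n) ≈ 0#
    poch-κ≉0 = ≉0-*ʳ (≉0-*ˡ (≉0-*ˡ h₂))
    poch-α₅-q≉0 : ¬ poch (a * q ÷ b) q (2 ℕ.* suc n) ≈ 0#
    poch-α₅-q≉0 = ≉0-*ʳ (≉0-*ˡ h₂)
    poch-β₃-q≉0 : ¬ poch (- (a ÷ b)) q (2 ℕ.* suc n) ≈ 0#
    poch-β₃-q≉0 = ≉0-*ʳ h₂

    κ≉0 : ¬ κ ≈ 0#
    κ≉0 = ≉0-*ʳ (poch-≉0-≤ _ Q {1} {suc n} (s≤s z≤n) poch-κ≉0)

    -- (β₁ n; Q)_{n+2} = (β₁ (n+1); Q)_{n+1} (1 - β₁ n), and 1 - β₁ n is a product of two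
    -- factors of the q-Pochhammer symbols with base q in Den (n+1).
    poch-β₁-long≉0 : ¬ poch (β₁ n) Q (suc (suc n)) ≈ 0#
    poch-β₁-long≉0 = ≉0-resp-≈ (sym (poch-suc′ Q (suc n) (β₁-shift n)))
      (≉0-* poch-β₁≉0 (≉0-resp-≈ (sym (β₁-factorisation n))
        (≉0-* (poch-factor-≉0 _ q (suc≤2*suc n) poch-α₅-q≉0) (poch-factor-≉0 _ q (2+≤2*suc n) poch-β₃-q≉0))))
      where
      suc≤2*suc : ∀ n → suc n ≤ 2 ℕ.* suc n
      suc≤2*suc n rewrite 2*suc n = ℕ.m≤n⇒m≤1+n (s≤s (ℕ.m≤m+n n (n ℕ.+ 0)))
      2+≤2*suc : ∀ n → suc (suc n) ≤ 2 ℕ.* suc n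
      2+≤2*suc n rewrite 2*suc n = s≤s (s≤s (ℕ.m≤m+n n (n ℕ.+ 0)))

    poch-β₂′≉0 : ¬ poch (β₂′ n) Q (suc n) ≈ 0#
    poch-β₂′≉0 = ≉0-resp-≈ (poch-congˡ Q (suc n) (β₂-suc n)) poch-β₂≉0

    H₁-pred : H₁ n
    H₁-pred = ≉0-* (≉0-* (≉0-* (≉0-* poch-β₁-n≉0 poch-β₂-n≉0) (shorten poch-β₃≉0)) (shorten poch-α₅≉0)) (shorten poch-Q≉0)
      where
      shorten : ∀ {x} → ¬ poch x Q (suc n) ≈ 0# → ¬ poch x Q n ≈ 0#
      shorten = poch-≉0-≤ _ Q (ℕ.n≤1+n n)
      poch-β₁-n≉0 : ¬ poch (β₁ n) Q n ≈ 0#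
      poch-β₁-n≉0 = poch-≉0-≤ _ Q (ℕ.m≤n⇒m≤1+n (ℕ.n≤1+n n)) poch-β₁-long≉0
      poch-β₂-n≉0 : ¬ poch (β₂ n) Q n ≈ 0#
      poch-β₂-n≉0 = ≉0-resp-≈ (poch-congˡ Q n (trans (*-congʳ (β₂-suc n)) (β₂′-shift n)))
                      (≉0-*ʳ (≉0-resp-≈ (poch-suc _ Q n) poch-β₂≉0))

    H₂-pred : H₂ n
    H₂-pred = ≉0-* (≉0-* (≉0-* (poch-≉0-≤ _ Q (ℕ.n≤1+n n) poch-b²≉0) (poch-≉0-≤ _ Q (ℕ.n≤1+n n) poch-κ≉0))
                          (poch-≉0-≤ _ q 2n≤2*suc poch-α₅-q≉0)) (poch-≉0-≤ _ q 2n≤2*suc poch-β₃-q≉0)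
      where
      2n≤2*suc : 2 ℕ.* n ≤ 2 ℕ.* suc n
      2n≤2*suc = ℕ.*-monoʳ-≤ 2 (ℕ.n≤1+n n)

    interior-den≉0 : ∀ j → suc (suc j) ≤ n → ¬ Interior.den n j ≈ 0#
    interior-den≉0 j j+2≤n =
      ≉0-* (≉0-* (≉0-* (≉0-* (≉0-* (poch-≉0-≤ _ Q (ℕ.m≤n⇒m≤1+n j+2≤n′) poch-β₁-long≉0)
        (poch-≉0-≤ _ Q j+2≤n′ poch-β₂′≉0))
        (poch-≉0-≤ _ Q (s≤s j+2≤n) poch-β₃≉0))
        (poch-≉0-≤ _ Q j+2≤n′ poch-α₅≉0))
        (poch-≉0-≤ _ Q (ℕ.≤-trans (ℕ.n≤1+n (suc j)) j+2≤n′) poch-Q≉0))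
        κ≉0
      where
      j+2≤n′ : suc (suc j) ≤ suc n
      j+2≤n′ = ℕ.m≤n⇒m≤1+n j+2≤n

    initial-den≉0 : 1 ≤ n → ¬ Initial.den n ≈ 0#
    initial-den≉0 1≤n =
      ≉0-* (≉0-* (≉0-* (≉0-* (≉0-* (poch-≉0-≤ _ Q {1} {suc (suc n)} (s≤s z≤n) poch-β₁-long≉0)
        (poch-≉0-≤ _ Q {1} {suc n} (s≤s z≤n) poch-β₂′≉0)) (poch-≉0-≤ _ Q {2} {suc n} (s≤s 1≤n) poch-β₃≉0))
        (poch-≉0-≤ _ Q {1} {suc n} (s≤s z≤n) poch-α₅≉0)) 1≉0) κ≉0

  hypotheses-pred : ∀ n → H₁ (suc n) × H₂ (suc n) → H₁ n × H₂ n
  hypotheses-pred n (h₁ , h₂) = H₁-pred , H₂-pred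
    where open NonVanishing n h₁ h₂

  boundary-den≉0 : ∀ m → H₁ (suc (suc m)) → H₂ (suc (suc m)) → ¬ Boundary.den m ≈ 0#
  boundary-den≉0 m h₁ h₂ = ≉0-* (≉0-* (≉0-* (≉0-* (≉0-* poch-β₁-long≉0 poch-β₂′≉0) poch-β₃≉0) poch-α₅≉0) poch-Q≉0) κ≉0
    where open NonVanishing (suc m) h₁ h₂

  boundary₀-den≉0 : H₁ 1 → H₂ 1 → ¬ Boundary₀.den ≈ 0#
  boundary₀-den≉0 h₁ h₂ = ≉0-* (≉0-* (≉0-* (≉0-* (≉0-* poch-β₁≉0 poch-β₂≉0) poch-β₃≉0) poch-α₅≉0) poch-Q≉0) κ≉0
    where open NonVanishing 0 h₁ h₂

  S : ℕ → Carrier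
  S n = sumTo n (term n)

  top-identity : ∀ n → H₁ (suc n) → H₂ (suc n) →
    δ n * (term (suc n) n + term (suc n) (suc n)) - ν n * term n n ≈ 0# - G n n
  top-identity zero    h₁ h₂ = Boundary₀.identity (boundary₀-den≉0 h₁ h₂)
  top-identity (suc m) h₁ h₂ = Boundary.identity m (boundary-den≉0 m h₁ h₂)

  recurrence : ∀ n → H₁ (suc n) × H₂ (suc n) → δ n * S (suc n) ≈ ν n * S n
  recurrence n (h₁ , h₂) =
    zeilberger-recurrence (term (suc n)) (term n) (G n) (δ n) (ν n) n refl local (top-identity n h₁ h₂)
    where
    open NonVanishing n h₁ h₂
    local : ∀ k → k < n → δ n * term (suc n) k - ν n * term n k ≈ G n (suc k) - G n k
    local zero    1≤n   = Initial.identity n (initial-den≉0 1≤n)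
    local (suc j) j+2≤n = Interior.identity n j (interior-den≉0 j j+2≤n)

  Den₀*S₀≈Num₀ : Den 0 * S 0 ≈ Num 0
  Den₀*S₀≈Num₀ = trans (*-congˡ S0≈1) (*-identityʳ _)
    where
    1⁵≈1 : 1# * 1# * 1# * 1# * 1# ≈ 1#
    1⁵≈1 = trans (*-identityʳ _) (trans (*-identityʳ _) (trans (*-identityʳ _) (*-identityʳ _)))
    S0≈1 : S 0 ≈ 1#
    S0≈1 = trans (*-identityʳ _) (trans (*-cong 1⁵≈1 (⁻¹-unique (trans (*-identityʳ _) 1⁵≈1))) (*-identityʳ 1#))

  closed-form : ∀ n → H₁ n → H₂ n → S n ≈ Num n ÷ Den n
  closed-form n h₁ h₂ = y*x≈z⇒x≈z÷y h₂
    (first-order-recurrence (λ n → H₁ n × H₂ n) S Den Num δ ν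
      hypotheses-pred Den₀*S₀≈Num₀ Den-suc Num-suc recurrence n (h₁ , h₂))

mainTheorem11 : ∀ {c ℓ} (F : Field c ℓ) → let open Field F in let open FieldOps F in
  CharZero →
  (q a b : Carrier) (n : ℕ) →
  ¬ (q ≈ 0#) → ¬ (a ≈ 0#) → ¬ (b ≈ 0#) →
  ¬ (poch ((a * a) * q ^ (2 ℕ.+ 2 ℕ.* n) ÷ (b * b)) (q * q) n
      * poch (- (a * q ^ 3 * (q ⁻¹) ^ (2 ℕ.* n) ÷ (b * b))) (q * q) n
      * poch (- (a ÷ b)) (q * q) n
      * poch (a * q ÷ b) (q * q) n
      * poch (q * q) (q * q) n ≈ 0#) →
  ¬ (poch (b * b) (q * q) n * poch (- ((b * b) ÷ (a * q))) (q * q) n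
      * poch (a * q ÷ b) q (2 ℕ.* n) * poch (- (a ÷ b)) q (2 ℕ.* n) ≈ 0#) →
  sumTo n (λ k →
      (poch ((q ⁻¹) ^ (2 ℕ.* n)) (q * q) k
        * poch (- (a * (q * q) ÷ b)) (q * q) k
        * poch ((a * a) * (q * q) ÷ b ^ 4) (q * q) k
        * poch (- (a * q ^ (2 ℕ.* n) * q ⁻¹)) (q * q) k
        * poch (a * q ÷ b) (q * q) k)
      ÷ (poch ((a * a) * q ^ (2 ℕ.+ 2 ℕ.* n) ÷ (b * b)) (q * q) k
        * poch (- (a * q ^ 3 * (q ⁻¹) ^ (2 ℕ.* n) ÷ (b * b))) (q * q) k
        * poch (- (a ÷ b)) (q * q) k
        * poch (a * q ÷ b) (q * q) k
        * poch (q * q) (q * q) k)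
      * (q * q) ^ k)
  ≈ (poch (- (a * q ÷ (b * b))) (q * q) n * poch ((a * a) * (q * q) ÷ (b * b)) (q * q) n
      * poch b q (2 ℕ.* n) * poch (- (b * q ⁻¹)) q (2 ℕ.* n))
    ÷ (poch (b * b) (q * q) n * poch (- ((b * b) ÷ (a * q))) (q * q) n
      * poch (a * q ÷ b) q (2 ℕ.* n) * poch (- (a ÷ b)) q (2 ℕ.* n))
mainTheorem11 F _ q a b n q≉0 a≉0 b≉0 = Summation.closed-form F q a b q≉0 a≉0 b≉0 n
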